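{- Let $V_n\subseteq S_n$ be the set of permutations whose Schensted insertion produces no lateral bumps, and let $C_n$ be the set of $n\times n$ permutation matrices $\alpha$ such that the coefficient of $z^\alpha$ in $[P_\alpha\mid Q_\alpha]$ is $0$. Then $\lim_{n\to\infty}\frac{|V_n|}{n!}=0$ if and only if $\lim_{n\to\infty}\frac{|C_n|}{n!}=1$.
   Context: Schensted insertion (French notation): insert $w_1,\dots,w_n$ successively into an initially empty tableau; a number $x$ inserted into a row is appended if it exceeds all entries (or the row is empty), otherwise it replaces the smallest entry $y>x$, and $y$ is bumped into the next row up and inserted by the same rule. A bump of $y$ from column $j$ is vertical if $y$ lands in column $j$ of the next row, and lateral otherwise. For an $n\times n$ permutation matrix $\alpha$, let $w_\alpha=w_1\cdots w_n$ with $\alpha_{w_i,i}=1$, $z^\alpha=\prod_i z_{w_i,i}$, $P_\alpha$ the Schensted insertion tableau of $w_\alpha$ and $Q_\alpha$ its recording tableau ($i$ placed in the box created at step $i$). For standard Young tableaux $P,Q$ of the same shape $\lambda$, $[P\mid Q]=\prod_{j=1}^{\lambda_1}\Delta_j$, where $\Delta_j$ is the determinant of the submatrix of $(z_{i,k})_{i,k\ge1}$ with rows indexed by the entries of column $j$ of $P$ and columns by the entries of column $j$ of $Q$. -}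

module Defs where

open import Data.Nat as ℕ using (ℕ; zero; suc; _≡ᵇ_; _<ᵇ_; _≥_; _!)
open import Data.Nat.Properties using (_!≢0)
open import Data.Integer as ℤ using (ℤ; +_)
open import Data.Rational as ℚ using (ℚ; _<_; ∣_∣; _-_)
open import Data.Bool using (Bool; true; false; _∧_; _∨_; not; if_then_else_)
open import Data.List as L using (List; []; _∷_; length; map; filter; concatMap; foldr; upTo; _++_)
open import Data.Maybe using (Maybe; just; nothing)
open import Data.Product using (_×_; _,_; proj₁; proj₂; ∃-syntax)
open import Relation.Nullary.Decidable using (does)

-- Permutations of a list, together with their signs.
-- A permutation of [1..n] is represented in one-line notation as the
-- list  w₁ ⋯ wₙ  (so the permutation matrix α has α_{wᵢ,i} = 1).

insAll : {A : Set} → A → List A → List (ℤ × List A)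
insAll y []       = (ℤ.+ 1 , y ∷ []) ∷ []
insAll y (x ∷ xs) = (ℤ.+ 1 , y ∷ x ∷ xs) ∷ map (λ p → (ℤ.- proj₁ p , x ∷ proj₂ p)) (insAll y xs)

signedPerms : {A : Set} → List A → List (ℤ × List A)
signedPerms []       = (ℤ.+ 1 , []) ∷ []
signedPerms (y ∷ ys) =
  concatMap (λ p → map (λ q → (proj₁ p ℤ.* proj₁ q , proj₂ q)) (insAll y (proj₂ p)))
            (signedPerms ys)

range1 : ℕ → List ℕ
range1 n = map suc (upTo n)

Sym : ℕ → List (List ℕ)
Sym n = map proj₂ (signedPerms (range1 n))

-- Schensted row insertion.
-- A tableau (French notation) is a list of rows, the first being the
-- bottom row; columns are 0-indexed positions within rows.

-- rowIns x r = (new row , column where x lands , bumped entry if any)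
rowIns : ℕ → List ℕ → List ℕ × ℕ × Maybe ℕ
rowIns x []      = x ∷ [] , 0 , nothing
rowIns x (y ∷ r) with x <ᵇ y
... | true  = x ∷ r , 0 , just y
... | false with rowIns x r
...   | r' , c , m = y ∷ r' , suc c , m

Tableau : Set
Tableau = List (List ℕ)

record InsResult : Set where
  constructor ires
  field
    tab     : Tableau
    landCol : ℕ     -- column where the inserted number lands (in the first row it enters)
    lateral : Bool
    newRow  : ℕ     -- row index of the newly created box

open InsResult public

tabIns : ℕ → Tableau → InsResult
tabIns x []       = ires ((x ∷ []) ∷ []) 0 false 0
tabIns x (r ∷ rs) with rowIns x r
... | r' , c , nothing = ires (r' ∷ rs) c false 0
... | r' , c , just y  with tabIns y rs
...   | ires rs' c' lat k =
          -- y was bumped from column c and lands in column c' of the next row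
          ires (r' ∷ rs') c (lat ∨ not (c ≡ᵇ c')) (suc k)

addAt : ℕ → ℕ → Tableau → Tableau
addAt i k       []       = (i ∷ []) ∷ []
addAt i zero    (r ∷ rs) = (r ++ (i ∷ [])) ∷ rs
addAt i (suc k) (r ∷ rs) = r ∷ addAt i k rs

record RSKState : Set where
  constructor st
  field
    Pt   : Tableau
    Qt   : Tableau
    step : ℕ
    anyLateral : Bool

open RSKState public

rskStep : RSKState → ℕ → RSKState
rskStep (st P Q i lat) x with tabIns x P
... | ires P' _ lat' k = st P' (addAt (suc i) k Q) (suc i) (lat ∨ lat')

rsk : List ℕ → RSKState
rsk w = L.foldl rskStep (st [] [] 0 false) w

Ptab : List ℕ → Tableau
Ptab w = Pt (rsk w)

Qtab : List ℕ → Tableau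
Qtab w = Qt (rsk w)

noLateral : List ℕ → Bool
noLateral w = not (anyLateral (rsk w))

nth : ℕ → List ℕ → Maybe ℕ
nth _       []       = nothing
nth zero    (x ∷ _)  = just x
nth (suc j) (_ ∷ xs) = nth j xs

-- entries of column j (0-indexed), bottom to top
column : ℕ → Tableau → List ℕ
column j []       = []
column j (r ∷ rs) with nth j r
... | just x  = x ∷ column j rs
... | nothing = column j rs

numCols : Tableau → ℕ
numCols []      = 0
numCols (r ∷ _) = length r

-- A monomial ∏ z_{a,b} is represented by the list of its factors (a , b).
Monomial : Set
Monomial = List (ℕ × ℕ)

-- Leibniz expansion of Δ = det (z_{pᵣ, q_s}) : list of signed monomials
detTerms : List ℕ → List ℕ → List (ℤ × Monomial)
detTerms ps qs =
  map (λ s → proj₁ s , L.zipWith _,_ ps (proj₂ s)) (signedPerms qs)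

mulTerms : List (ℤ × Monomial) → List (ℤ × Monomial) → List (ℤ × Monomial)
mulTerms f g = concatMap (λ a → map (λ b → (proj₁ a ℤ.* proj₁ b , proj₂ a ++ proj₂ b)) g) f

-- expansion of [P | Q] = ∏_{j=1}^{λ₁} Δ_j
bitableauTerms : Tableau → Tableau → List (ℤ × Monomial)
bitableauTerms P Q =
  foldr (λ j acc → mulTerms (detTerms (column j P) (column j Q)) acc)
        ((ℤ.+ 1 , []) ∷ []) (upTo (numCols P))

expo : ℕ → ℕ → Monomial → ℕ
expo a b []             = 0
expo a b ((c , d) ∷ m) = (if (c ≡ᵇ a) ∧ (d ≡ᵇ b) then 1 else 0) ℕ.+ expo a b m

-- the word w (one-line notation) as a permutation matrix: α_{a,b} = 1 iff w_b = a
matEntry : List ℕ → ℕ → ℕ → ℕ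
matEntry w a b with nth (ℕ.pred b) w
... | just x  = if x ≡ᵇ a then 1 else 0
... | nothing = 0

allB : {A : Set} → (A → Bool) → List A → Bool
allB p []       = true
allB p (x ∷ xs) = p x ∧ allB p xs

-- the monomial m equals z^α (α the matrix of w, n = |w|), i.e. all
-- exponents agree; variables z_{a,b} with a or b outside 1..n cannot occur
-- in [P_α | Q_α], whose entries all lie in 1..n, but we also require them absent.
isZAlpha : List ℕ → Monomial → Bool
isZAlpha w m =
  allB (λ a → allB (λ b → expo a b m ≡ᵇ matEntry w a b) (range1 (length w))) (range1 (length w))
  ∧ (length m ≡ᵇ length w)

coeffZAlpha : List ℕ → ℤ
coeffZAlpha w =
  foldr (λ t acc → (if isZAlpha w (proj₂ t) then proj₁ t else ℤ.+ 0) ℤ.+ acc) (ℤ.+ 0)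
        (bitableauTerms (Ptab w) (Qtab w))

isZeroℤ : ℤ → Bool
isZeroℤ (ℤ.+ 0) = true
isZeroℤ _       = false

V : ℕ → List (List ℕ)
V n = L.filterᵇ noLateral (Sym n)

C : ℕ → List (List ℕ)
C n = L.filterᵇ (λ w → isZeroℤ (coeffZAlpha w)) (Sym n)

ratio : (ℕ → List (List ℕ)) → ℕ → ℚ
ratio X n = (ℤ.+ length (X n) ℚ./ (n !)) {{n !≢0}}

_⟶_ : (ℕ → ℚ) → ℚ → Set
f ⟶ ℓ = ∀ (ε : ℚ) → ℚ.0ℚ < ε → ∃[ N ] (∀ n → n ≥ N → ∣ f n - ℓ ∣ < ε)

-- The monomial z^α takes exactly one variable from each column index 1, …, n,
-- and the columns of Q_α partition {1, …, n}; so the coefficient of z^α in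
-- [P_α | Q_α] = ∏ⱼ Δⱼ is the product over j of the coefficient of
-- ∏_{q ∈ column j of Q_α} z_{w_q, q} in Δⱼ, which is ±1 if the letters w_q for
-- q in column j of Q_α are exactly column j of P_α, and 0 otherwise.  During
-- Schensted insertion entries of P only move weakly left, and when every bump
-- of a step is vertical the inserted letter w_i ends in the column of the new
-- box i of Q.  Without lateral bumps every letter w_i therefore lies in the
-- column of i, and the coefficient is ±1; a lateral bump pushes some w_i
-- strictly left of the column of i for good, and the coefficient is 0.  Hence
-- C_n is the complement of V_n in S_n, |V_n|/n! + |C_n|/n! = 1, and the two
-- limits are equivalent.

module Submission where

open import Defs
open import Data.Nat as ℕ using (ℕ; zero; suc; _≤_; _<_; z≤n; s≤s; _≡ᵇ_; _<ᵇ_; _!)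
open import Data.Nat.Properties
open import Data.List as L using (List; []; _∷_; _++_; length; map; concat; [_]; upTo)
open import Data.List.Properties
  using ( length-++; length-++-sucʳ; length-map; length-upTo; ++-assoc; ++-identityʳ; map-++; upTo-∷ʳ
        ; map-upTo; concatMap-cong; ∷-injective)
open import Data.Integer using (ℤ; +_; _+_; _*_; -_)
import Data.Integer.Properties as ℤ
open import Data.Rational as ℚ using (ℚ; 0ℚ; 1ℚ; ∣_∣; _-_)
import Data.Rational.Properties as ℚ
open import Data.Rational.Unnormalised as ℚᵘ using (mkℚᵘ)
import Data.Rational.Unnormalised.Properties as ℚᵘ
open import Data.Maybe using (Maybe; just; nothing)
open import Data.Maybe.Properties using (just-injective)
open import Data.Product using (∃; _×_; _,_; proj₁; proj₂)
open import Data.Sum using (_⊎_; inj₁; inj₂)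
open import Data.Bool using (Bool; true; false; _∨_; _∧_; not; T; if_then_else_)
open import Data.Bool.Properties
  using ( ∨-conicalˡ; ∨-conicalʳ; T-≡; not-injective; ¬-not; ∧-assoc; ∧-conicalˡ; ∧-conicalʳ; ∧-zeroʳ
        ; ∧-identityʳ; not-involutive)
  renaming (_≟_ to _≟ᵇ_)
open import Data.Unit using (tt; ⊤)
open import Data.Empty using (⊥-elim)
open import Function using (_∘_; _∋_; Equivalence)
open import Relation.Nullary using (¬_; yes; no)
open import Relation.Binary.PropositionalEquality hiding ([_])
open import Data.List.Relation.Unary.All as All using (All; []; _∷_)
import Data.List.Relation.Unary.All.Properties as All
open import Data.List.Relation.Unary.Any using (Any; here; there)
open import Data.List.Relation.Unary.AllPairs using (AllPairs; []; _∷_)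
import Data.List.Relation.Unary.AllPairs.Properties as AllPairs
open import Data.List.Membership.Propositional using (_∈_; _∉_; find)
open import Data.List.Membership.Propositional.Properties
  using (∈-++⁺ˡ; ∈-++⁺ʳ; ∈-map⁻; ∈-concatMap⁻; ∈-∃++; ∈-upTo⁻; ∈-upTo⁺; ∈-map⁺)
open import Data.List.Relation.Unary.Unique.Propositional using (Unique)
import Data.List.Relation.Unary.Unique.Propositional.Properties as Unique
open import Data.List.Relation.Binary.Permutation.Propositional
  using (_↭_; ↭-refl; ↭-sym; ↭-trans; ↭-prep; ↭-swap; ↭-reflexive; ↭⇒↭ₛ; module PermutationReasoning)
open import Data.List.Relation.Binary.Permutation.Propositional.Properties
  using (++⁺; ++⁺ˡ; shift; shifts; ∈-resp-↭; ∷↭∷ʳ; ↭-empty-inv; drop-mid; ↭-length)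
import Data.List.Relation.Binary.Permutation.Setoid.Properties as Permₛ
open import Data.List.Relation.Binary.BagAndSetEquality using (∼bag⇒↭)
open import Data.List.Membership.Propositional.Properties.WithK using (unique∧set⇒bag)
open import Function.Bundles using (_⇔_; mk⇔)

∨≡true⇒⊎ : ∀ a {b} → a ∨ b ≡ true → a ≡ true ⊎ b ≡ true
∨≡true⇒⊎ true  _  = inj₁ refl
∨≡true⇒⊎ false eq = inj₂ eq

≡ᵇ≡true⇒≡ : ∀ {m n} → (m ≡ᵇ n) ≡ true → m ≡ n
≡ᵇ≡true⇒≡ {m} {n} eq = ≡ᵇ⇒≡ m n (Equivalence.from T-≡ eq)

≡⇒≡ᵇ≡true : ∀ {m n} → m ≡ n → (m ≡ᵇ n) ≡ true
≡⇒≡ᵇ≡true {m} {n} eq = Equivalence.to T-≡ (≡⇒≡ᵇ m n eq)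

≢⇒≡ᵇ≡false : ∀ {m n} → m ≢ n → (m ≡ᵇ n) ≡ false
≢⇒≡ᵇ≡false {m} {n} m≢n with m ≡ᵇ n in eq
... | true  = ⊥-elim (m≢n (≡ᵇ≡true⇒≡ eq))
... | false = refl

not-≡ᵇ≡false⇒≡ : ∀ {m n} → not (m ≡ᵇ n) ≡ false → m ≡ n
not-≡ᵇ≡false⇒≡ eq = ≡ᵇ≡true⇒≡ (not-injective {y = true} eq)

not-≡ᵇ≡true⇒≢ : ∀ {m n} → not (m ≡ᵇ n) ≡ true → m ≢ n
not-≡ᵇ≡true⇒≢ eq m≡n with trans (sym (not-injective {y = false} eq)) (≡⇒≡ᵇ≡true m≡n)
... | ()

<ᵇ≡true⇒< : ∀ {x y} → (x <ᵇ y) ≡ true → x < y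
<ᵇ≡true⇒< {x} {y} eq = <ᵇ⇒< x y (Equivalence.from T-≡ eq)

<ᵇ≡false⇒≥ : ∀ {x y} → (x <ᵇ y) ≡ false → y ≤ x
<ᵇ≡false⇒≥ eq = ≮⇒≥ (λ x<y → subst T eq (<⇒<ᵇ x<y))

≡true⇔⇒≡ : ∀ {a b} → (a ≡ true → b ≡ true) → (b ≡ true → a ≡ true) → a ≡ b
≡true⇔⇒≡ {false} {false} _ _ = refl
≡true⇔⇒≡ {false} {true}  _ ⇐ = ⇐ refl
≡true⇔⇒≡ {true}  {false} ⇒ _ = sym (⇒ refl)
≡true⇔⇒≡ {true}  {true}  _ _ = refl

module _ {A : Set} (f : A → Bool) where

  allB-++ : ∀ xs ys → allB f (xs ++ ys) ≡ allB f xs ∧ allB f ys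
  allB-++ []       ys = refl
  allB-++ (x ∷ xs) ys = trans (cong (f x ∧_) (allB-++ xs ys)) (sym (∧-assoc (f x) _ _))

  allB⇒All : ∀ xs → allB f xs ≡ true → All (λ x → f x ≡ true) xs
  allB⇒All []       _  = []
  allB⇒All (x ∷ xs) eq = ∧-conicalˡ (f x) _ eq ∷ allB⇒All xs (∧-conicalʳ (f x) _ eq)

  All⇒allB : ∀ xs → All (λ x → f x ≡ true) xs → allB f xs ≡ true
  All⇒allB []       []           = refl
  All⇒allB (x ∷ xs) (fx≡ ∷ fxs≡) rewrite fx≡ = All⇒allB xs fxs≡

nth-++ˡ : ∀ {i} (as bs : List ℕ) → i < length as → nth i (as ++ bs) ≡ nth i as
nth-++ˡ {zero}  (a ∷ as) bs _       = refl
nth-++ˡ {suc i} (a ∷ as) bs (s≤s p) = nth-++ˡ as bs p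

nth-middle : ∀ (as : List ℕ) x bs → nth (length as) (as ++ x ∷ bs) ≡ just x
nth-middle []       x bs = refl
nth-middle (a ∷ as) x bs = nth-middle as x bs

nth-replace : ∀ i (as : List ℕ) x y bs → i ≢ length as →
              nth i (as ++ x ∷ bs) ≡ nth i (as ++ y ∷ bs)
nth-replace zero    []       x y bs i≢0 = ⊥-elim (i≢0 refl)
nth-replace (suc i) []       x y bs _   = refl
nth-replace zero    (a ∷ as) x y bs _   = refl
nth-replace (suc i) (a ∷ as) x y bs i≢  = nth-replace i as x y bs (i≢ ∘ cong suc)

nth-∷ʳ : ∀ i (r : List ℕ) x → i ≢ length r → nth i (r ++ [ x ]) ≡ nth i r
nth-∷ʳ zero    []      x i≢0 = ⊥-elim (i≢0 refl)
nth-∷ʳ (suc i) []      x _   = refl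
nth-∷ʳ zero    (a ∷ r) x _   = refl
nth-∷ʳ (suc i) (a ∷ r) x i≢  = nth-∷ʳ i r x (i≢ ∘ cong suc)

nth⇒∈ : ∀ {i z} (r : List ℕ) → nth i r ≡ just z → z ∈ r
nth⇒∈ {zero}  (a ∷ r) refl = here refl
nth⇒∈ {suc i} (a ∷ r) eq   = there (nth⇒∈ r eq)

nth⇒<length : ∀ {i z} (r : List ℕ) → nth i r ≡ just z → i < length r
nth⇒<length {zero}  (a ∷ r) _  = s≤s z≤n
nth⇒<length {suc i} (a ∷ r) eq = s≤s (nth⇒<length r eq)

<length⇒nth : ∀ {i} (r : List ℕ) → i < length r → ∃ λ z → nth i r ≡ just z
<length⇒nth {zero}  (a ∷ r) _       = a , refl
<length⇒nth {suc i} (a ∷ r) (s≤s p) = <length⇒nth r p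

nth≡nothing⇒length≤ : ∀ j (r : List ℕ) → nth j r ≡ nothing → length r ≤ j
nth≡nothing⇒length≤ j       []      _  = z≤n
nth≡nothing⇒length≤ (suc j) (a ∷ r) eq = s≤s (nth≡nothing⇒length≤ j r eq)

∈⇒nth : ∀ {z} (r : List ℕ) → z ∈ r → ∃ λ i → nth i r ≡ just z
∈⇒nth (a ∷ r) (here refl) = 0 , refl
∈⇒nth (a ∷ r) (there z∈r) = let i , eq = ∈⇒nth r z∈r in suc i , eq

nth-injective : ∀ {i j z} (r : List ℕ) → Unique r →
                nth i r ≡ just z → nth j r ≡ just z → i ≡ j
nth-injective {zero}  {zero}  (a ∷ r) _          _    _    = refl
nth-injective {zero}  {suc j} (a ∷ r) (a∉ ∷ _)   refl eq   = ⊥-elim (All.lookup a∉ (nth⇒∈ r eq) refl)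
nth-injective {suc i} {zero}  (a ∷ r) (a∉ ∷ _)   eq   refl = ⊥-elim (All.lookup a∉ (nth⇒∈ r eq) refl)
nth-injective {suc i} {suc j} (a ∷ r) (_ ∷ uniq) eq₁  eq₂  = cong suc (nth-injective r uniq eq₁ eq₂)

All-nth : ∀ {P : ℕ → Set} {i z} (r : List ℕ) → All P r → nth i r ≡ just z → P z
All-nth r all eq = All.lookup all (nth⇒∈ r eq)

AllPairs-nth : ∀ {i j a b} (r : List ℕ) → AllPairs _<_ r → i < j →
               nth i r ≡ just a → nth j r ≡ just b → a < b
AllPairs-nth {zero}  {suc j} (c ∷ r) (c< ∷ _)  _         refl eq₂ = All-nth r c< eq₂
AllPairs-nth {suc i} {suc j} (c ∷ r) (_ ∷ sr) (s≤s i<j) eq₁  eq₂ = AllPairs-nth r sr i<j eq₁ eq₂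

Unique-++⁻ˡ : ∀ (xs : List ℕ) {ys} → Unique (xs ++ ys) → Unique xs
Unique-++⁻ˡ []       _           = []
Unique-++⁻ˡ (x ∷ xs) (x∉ ∷ uniq) = All.++⁻ˡ xs x∉ ∷ Unique-++⁻ˡ xs uniq

Unique-++⁻ʳ : ∀ (xs : List ℕ) {ys} → Unique (xs ++ ys) → Unique ys
Unique-++⁻ʳ []       uniq       = uniq
Unique-++⁻ʳ (x ∷ xs) (_ ∷ uniq) = Unique-++⁻ʳ xs uniq

Unique-++⇒∉ : ∀ (xs : List ℕ) {ys z} → Unique (xs ++ ys) → z ∈ xs → z ∉ ys
Unique-++⇒∉ (x ∷ xs) (x∉ ∷ _)    (here refl) z∈ys = All.lookup (All.++⁻ʳ xs x∉) z∈ys refl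
Unique-++⇒∉ (x ∷ xs) (_ ∷ uniq)  (there z∈xs) z∈ys = Unique-++⇒∉ xs uniq z∈xs z∈ys

Unique-resp-↭ : ∀ {xs ys : List ℕ} → xs ↭ ys → Unique xs → Unique ys
Unique-resp-↭ p = Permₛ.Unique-resp-↭ (setoid ℕ) (↭⇒↭ₛ p)

Unique-⊆⊇⇒↭ : ∀ {xs ys : List ℕ} → Unique xs → Unique ys →
              (∀ {z} → z ∈ xs → z ∈ ys) → (∀ {z} → z ∈ ys → z ∈ xs) → xs ↭ ys
Unique-⊆⊇⇒↭ uxs uys ⊆ ⊇ = ∼bag⇒↭ (unique∧set⇒bag uxs uys (mk⇔ ⊆ ⊇))

position : ℕ → List ℕ → ℕ
position p []       = 0
position p (a ∷ as) = if a ≡ᵇ p then 0 else suc (position p as)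

nth-position : ∀ p (v : List ℕ) → p ∈ v → nth (position p v) v ≡ just p
nth-position p (a ∷ as) p∈ with a ≡ᵇ p in a≡ᵇp
... | true  = cong just (≡ᵇ≡true⇒≡ a≡ᵇp)
... | false with p∈
...   | here refl with () ← trans (sym a≡ᵇp) (≡⇒≡ᵇ≡true {a} refl)
...   | there p∈as = nth-position p as p∈as

All≤∧∉⇒All< : ∀ {x} (as : List ℕ) → All (_≤ x) as → x ∉ as → All (_< x) as
All≤∧∉⇒All< []       []           _   = []
All≤∧∉⇒All< (a ∷ as) (a≤x ∷ as≤x) x∉ =
  ≤∧≢⇒< a≤x (λ a≡x → x∉ (here (sym a≡x))) ∷ All≤∧∉⇒All< as as≤x (x∉ ∘ there)

All-replace : ∀ {P : ℕ → Set} (as : List ℕ) {x y bs} → All P (as ++ y ∷ bs) → P x → All P (as ++ x ∷ bs)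
All-replace []       (_ ∷ pbs)  px = px ∷ pbs
All-replace (a ∷ as) (pa ∷ pas) px = pa ∷ All-replace as pas px

AllPairs-replace : ∀ (as : List ℕ) {x y bs} → AllPairs _<_ (as ++ y ∷ bs) →
                   All (_< x) as → x < y → AllPairs _<_ (as ++ x ∷ bs)
AllPairs-replace []       (y< ∷ sorted) []          x<y = All.map (<-trans x<y) y< ∷ sorted
AllPairs-replace (a ∷ as) (a< ∷ sorted) (a<x ∷ as<x) x<y =
  All-replace as a< a<x ∷ AllPairs-replace as sorted as<x x<y

AllPairs-∷ʳ : ∀ (r : List ℕ) {x} → AllPairs _<_ r → All (_< x) r → AllPairs _<_ (r ++ [ x ])
AllPairs-∷ʳ r sorted r<x = AllPairs.++⁺ sorted ([] ∷ []) (All.map (_∷ []) r<x)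

length-∷ʳ : ∀ (r : List ℕ) x → length (r ++ [ x ]) ≡ suc (length r)
length-∷ʳ r x = trans (length-++ r) (+-comm (length r) 1)

++-∷ʳ-↭ : ∀ (r : List ℕ) x rest → (r ++ [ x ]) ++ rest ↭ x ∷ (r ++ rest)
++-∷ʳ-↭ r x rest = ↭-trans (↭-reflexive (++-assoc r [ x ] rest)) (shift x r rest)

++-replace-↭ : ∀ (as : List ℕ) x y bs {rest rest'} → rest' ↭ y ∷ rest →
               (as ++ x ∷ bs) ++ rest' ↭ x ∷ ((as ++ y ∷ bs) ++ rest)
++-replace-↭ as x y bs {rest} p = begin
  (as ++ x ∷ bs) ++ _         ↭⟨ ++⁺ˡ (as ++ x ∷ bs) p ⟩
  (as ++ x ∷ bs) ++ y ∷ rest  ≡⟨ ++-assoc as (x ∷ bs) (y ∷ rest) ⟩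
  as ++ x ∷ bs ++ y ∷ rest    ↭⟨ shift x as (bs ++ y ∷ rest) ⟩
  x ∷ as ++ bs ++ y ∷ rest    ↭⟨ ↭-prep x (++⁺ˡ as (shift y bs rest)) ⟩
  x ∷ as ++ y ∷ bs ++ rest    ≡⟨ cong (x ∷_) (++-assoc as (y ∷ bs) rest) ⟨
  x ∷ (as ++ y ∷ bs) ++ rest  ∎
  where open PermutationReasoning

-- Row insertion

data RowInsertion (x : ℕ) (r : List ℕ) : List ℕ × ℕ × Maybe ℕ → Set where
  bump   : ∀ as y bs → r ≡ as ++ y ∷ bs → All (_≤ x) as → x < y →
           RowInsertion x r (as ++ x ∷ bs , length as , just y)
  append : All (_≤ x) r → RowInsertion x r (r ++ [ x ] , length r , nothing)

rowIns-view : ∀ x r → RowInsertion x r (rowIns x r)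
rowIns-view x []      = append []
rowIns-view x (y ∷ r) with x <ᵇ y in x<ᵇy
... | true  = bump [] y r refl [] (<ᵇ≡true⇒< x<ᵇy)
... | false with rowIns x r | rowIns-view x r
...   | _ | bump as z bs refl as≤x x<z = bump (y ∷ as) z bs refl (<ᵇ≡false⇒≥ x<ᵇy ∷ as≤x) x<z
...   | _ | append r≤x                 = append (<ᵇ≡false⇒≥ x<ᵇy ∷ r≤x)

bottomRow : Tableau → List ℕ
bottomRow []      = []
bottomRow (r ∷ _) = r

Dominates : List ℕ → List ℕ → Set
Dominates r s = ∀ t b → nth t s ≡ just b → ∃ λ a → nth t r ≡ just a × a < b

Increasing : Tableau → Set
Increasing []       = ⊤
Increasing (r ∷ rs) = AllPairs _<_ r × Dominates r (bottomRow rs) × Increasing rs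

InColumn : ℕ → Tableau → ℕ → Set
InColumn j T z = Any (λ r → nth j r ≡ just z) T

Dominates-∷ʳ : ∀ (r : List ℕ) x s → Dominates r s → Dominates (r ++ [ x ]) s
Dominates-∷ʳ r x s dom t b s[t]=b =
  let a , r[t]=a , a<b = dom t b s[t]=b
  in a , trans (nth-++ˡ r [ x ] (nth⇒<length r r[t]=a)) r[t]=a , a<b

Dominates-bump : ∀ (r r' : List ℕ) c {x y} (s s' : List ℕ) p →
  nth c r ≡ just y → nth c r' ≡ just x → x < y → (∀ t → t ≢ c → nth t r' ≡ nth t r) →
  AllPairs _<_ r →
  nth p s' ≡ just y → (∀ t → t ≢ p → nth t s' ≡ nth t s) →
  (∀ t u → t < p → nth t s ≡ just u → u ≤ y) → p ≤ length s →
  Dominates r s → Dominates r' s' × p ≤ c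
Dominates-bump r r' c {x} {y} s s' p r[c]=y r'[c]=x x<y r'≈r sorted s'[p]=y s'≈s s<p≤y p≤len dom =
  dominates , p≤c
  where
  -- an entry of s in column c < p would be at most y, yet dominate y
  p≤c : p ≤ c
  p≤c with p ≤? c
  ... | yes p≤c = p≤c
  ... | no p≰c =
    let c<p     = ≰⇒> p≰c
        u , s[c]=u = <length⇒nth s (<-≤-trans c<p p≤len)
        a , r[c]=a , a<u = dom c u s[c]=u
    in ⊥-elim (<⇒≱ (subst (_< u) (just-injective (trans (sym r[c]=a) r[c]=y)) a<u) (s<p≤y c u c<p s[c]=u))

  dominates : Dominates r' s'
  dominates t b s'[t]=b with t ≟ p
  dominates t b s'[t]=b | yes refl with just-injective (trans (sym s'[p]=y) s'[t]=b)
  ... | refl with t ≟ c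
  ...   | yes refl = x , r'[c]=x , x<y
  ...   | no t≢c =
    let t<c = ≤∧≢⇒< p≤c t≢c
        a , r[t]=a = <length⇒nth r (<-trans t<c (nth⇒<length r r[c]=y))
    in a , trans (r'≈r t t≢c) r[t]=a , AllPairs-nth r sorted t<c r[t]=a r[c]=y
  dominates t b s'[t]=b | no t≢p with dom t b (trans (sym (s'≈s t t≢p)) s'[t]=b)
  ... | a , r[t]=a , a<b with t ≟ c
  ...   | yes refl = x , r'[c]=x , <-trans x<y (subst (_< b) (just-injective (trans (sym r[t]=a) r[c]=y)) a<b)
  ...   | no t≢c   = a , trans (r'≈r t t≢c) r[t]=a , a<b

Dominates-rowIns : ∀ as {x y} bs s → AllPairs _<_ (as ++ y ∷ bs) → x < y → Dominates (as ++ y ∷ bs) s →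
                   Dominates (as ++ x ∷ bs) (proj₁ (rowIns y s)) × proj₁ (proj₂ (rowIns y s)) ≤ length as
Dominates-rowIns as {x} {y} bs s sorted x<y dom with rowIns y s | rowIns-view y s
... | _ | bump as₂ y₂ bs₂ refl as₂≤y _ =
  Dominates-bump (as ++ y ∷ bs) (as ++ x ∷ bs) (length as) s (as₂ ++ y ∷ bs₂) (length as₂)
    (nth-middle as y bs) (nth-middle as x bs) x<y (λ t t≢ → nth-replace t as x y bs t≢) sorted
    (nth-middle as₂ y bs₂) (λ t t≢ → nth-replace t as₂ y y₂ bs₂ t≢)
    (λ t u t< s[t]=u → All-nth as₂ as₂≤y (trans (sym (nth-++ˡ as₂ (y₂ ∷ bs₂) t<)) s[t]=u))
    (subst (length as₂ ≤_) (sym (length-++ as₂)) (m≤m+n _ _)) dom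
... | _ | append s≤y =
  Dominates-bump (as ++ y ∷ bs) (as ++ x ∷ bs) (length as) s (s ++ [ y ]) (length s)
    (nth-middle as y bs) (nth-middle as x bs) x<y (λ t t≢ → nth-replace t as x y bs t≢) sorted
    (nth-middle s y []) (λ t t≢ → nth-∷ʳ t s y t≢) (λ t u _ s[t]=u → All-nth s s≤y s[t]=u) ≤-refl dom

InColumn⇒∈ : ∀ {T j z} → InColumn j T z → z ∈ concat T
InColumn⇒∈ {r ∷ rs} (here r[j]=z) = ∈-++⁺ˡ (nth⇒∈ r r[j]=z)
InColumn⇒∈ {r ∷ rs} (there z∈rs)  = ∈-++⁺ʳ r (InColumn⇒∈ z∈rs)

InColumn-unique : ∀ {T j j' z} → Unique (concat T) → InColumn j T z → InColumn j' T z → j ≡ j'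
InColumn-unique {r ∷ rs} uniq (here p)  (here q)  = nth-injective r (Unique-++⁻ˡ r uniq) p q
InColumn-unique {r ∷ rs} uniq (here p)  (there q) = ⊥-elim (Unique-++⇒∉ r uniq (nth⇒∈ r p) (InColumn⇒∈ q))
InColumn-unique {r ∷ rs} uniq (there p) (here q)  = ⊥-elim (Unique-++⇒∉ r uniq (nth⇒∈ r q) (InColumn⇒∈ p))
InColumn-unique {r ∷ rs} uniq (there p) (there q) = InColumn-unique (Unique-++⁻ʳ r uniq) p q

Dominates⇒length≤ : ∀ r s → Dominates r s → length s ≤ length r
Dominates⇒length≤ r s dom with length s in len≡
... | zero  = z≤n
... | suc m =
  let b , s[m]=b = <length⇒nth s (subst (m <_) (sym len≡) ≤-refl)
      a , r[m]=a , _ = dom m b s[m]=b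
  in nth⇒<length r r[m]=a

rows≤bottomRow : ∀ T → Increasing T → All (λ r → length r ≤ length (bottomRow T)) T
rows≤bottomRow []       _                 = []
rows≤bottomRow (r ∷ rs) (_ , dom , inc) =
  ≤-refl ∷ All.map (λ len≤ → ≤-trans len≤ (Dominates⇒length≤ r (bottomRow rs) dom)) (rows≤bottomRow rs inc)

InColumn⇒<width : ∀ {T j z} → Increasing T → InColumn j T z → j < length (bottomRow T)
InColumn⇒<width {T} {j} inc z∈T = go T z∈T (rows≤bottomRow T inc)
  where
  go : ∀ {z} U → InColumn j U z → All (λ r → length r ≤ length (bottomRow T)) U → j < length (bottomRow T)
  go (r ∷ _)  (here r[j]=z) (len≤ ∷ _) = <-≤-trans (nth⇒<length r r[j]=z) len≤
  go (_ ∷ rs) (there z∈rs)  (_ ∷ lens≤) = go rs z∈rs lens≤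

numCols≡length-bottomRow : ∀ T → numCols T ≡ length (bottomRow T)
numCols≡length-bottomRow []      = refl
numCols≡length-bottomRow (_ ∷ _) = refl

addBox : ℕ → List ℕ → List ℕ
addBox k       []       = 1 ∷ []
addBox zero    (l ∷ ls) = suc l ∷ ls
addBox (suc k) (l ∷ ls) = l ∷ addBox k ls

rowLength : ℕ → List ℕ → ℕ
rowLength k       []       = 0
rowLength zero    (l ∷ _)  = l
rowLength (suc k) (_ ∷ ls) = rowLength k ls

tabIns-bottomRow : ∀ x T → bottomRow (tab (tabIns x T)) ≡ proj₁ (rowIns x (bottomRow T))
                         × landCol (tabIns x T) ≡ proj₁ (proj₂ (rowIns x (bottomRow T)))
tabIns-bottomRow x []       = refl , refl
tabIns-bottomRow x (r ∷ rs) with rowIns x r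
... | _ , _ , nothing = refl , refl
... | _ , _ , just y with tabIns y rs
...   | _ = refl , refl

record InsertionSpec (T : Tableau) (x : ℕ) (R : InsResult) : Set where
  field
    increasing : Increasing (tab R)
    content    : concat (tab R) ↭ x ∷ concat T
    shape      : map length (tab R) ≡ addBox (newRow R) (map length T)
    moves-left : ∀ {z j} → InColumn j T z →
                 ∃ λ j' → InColumn j' (tab R) z × j' ≤ j × (lateral R ≡ false → j' ≡ j)
    lateral⇒moved : lateral R ≡ true →
                    ∃ λ z → ∃ λ j → ∃ λ j' → InColumn j T z × InColumn j' (tab R) z × j' < j
    lands      : InColumn (landCol R) (tab R) x
    vertical⇒lands-in-new-box : lateral R ≡ false → landCol R ≡ rowLength (newRow R) (map length T)

open InsertionSpec

empty-spec : ∀ x → InsertionSpec [] x (tabIns x [])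
empty-spec x = record
  { increasing    = ([] ∷ []) , (λ _ _ ()) , tt
  ; content       = ↭-refl
  ; shape         = refl
  ; moves-left    = λ ()
  ; lateral⇒moved = λ ()
  ; lands         = here refl
  ; vertical⇒lands-in-new-box = λ _ → refl
  }

append-spec : ∀ x r rs → Increasing (r ∷ rs) → All (_< x) r →
              InsertionSpec (r ∷ rs) x (ires ((r ++ [ x ]) ∷ rs) (length r) false 0)
append-spec x r rs (sorted , dom , inc) r<x = record
  { increasing    = AllPairs-∷ʳ r sorted r<x , Dominates-∷ʳ r x (bottomRow rs) dom , inc
  ; content       = ++-∷ʳ-↭ r x (concat rs)
  ; shape         = cong (_∷ map length rs) (length-∷ʳ r x)
  ; moves-left    = stays
  ; lateral⇒moved = λ ()
  ; lands         = here (nth-middle r x [])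
  ; vertical⇒lands-in-new-box = λ _ → refl
  }
  where
  stays : ∀ {z j} → InColumn j (r ∷ rs) z →
          ∃ λ j' → InColumn j' ((r ++ [ x ]) ∷ rs) z × j' ≤ j × (false ≡ false → j' ≡ j)
  stays {j = j} (here r[j]=z) = j , here (trans (nth-++ˡ r [ x ] (nth⇒<length r r[j]=z)) r[j]=z) , ≤-refl , λ _ → refl
  stays {j = j} (there z∈rs)  = j , there z∈rs , ≤-refl , λ _ → refl

bump-spec : ∀ as x y bs rs {rs' c' lat k} →
  Increasing ((as ++ y ∷ bs) ∷ rs) → All (_< x) as → x < y →
  bottomRow rs' ≡ proj₁ (rowIns y (bottomRow rs)) → c' ≡ proj₁ (proj₂ (rowIns y (bottomRow rs))) →
  InsertionSpec rs y (ires rs' c' lat k) →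
  InsertionSpec ((as ++ y ∷ bs) ∷ rs) x
                (ires ((as ++ x ∷ bs) ∷ rs') (length as) (lat ∨ not (length as ≡ᵇ c')) (suc k))
bump-spec as x y bs rs {rs'} {c'} {lat} (sorted , dom , inc) as<x x<y bottom≡ land≡ spec = record
  { increasing    = AllPairs-replace as sorted as<x x<y
                  , subst (Dominates (as ++ x ∷ bs)) (sym bottom≡) (proj₁ dominates)
                  , increasing spec
  ; content       = ++-replace-↭ as x y bs (content spec)
  ; shape         = cong₂ _∷_ (trans (length-++-sucʳ as x bs) (sym (length-++-sucʳ as y bs))) (shape spec)
  ; moves-left    = moves
  ; lateral⇒moved = moved
  ; lands         = here (nth-middle as x bs)
  ; vertical⇒lands-in-new-box = λ vertical →
      trans (not-≡ᵇ≡false⇒≡ (∨-conicalʳ lat _ vertical))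
            (vertical⇒lands-in-new-box spec (∨-conicalˡ lat _ vertical))
  }
  where
  dominates : Dominates (as ++ x ∷ bs) (proj₁ (rowIns y (bottomRow rs)))
            × proj₁ (proj₂ (rowIns y (bottomRow rs))) ≤ length as
  dominates = Dominates-rowIns as bs (bottomRow rs) sorted x<y dom

  c'≤ : c' ≤ length as
  c'≤ = subst (_≤ length as) (sym land≡) (proj₂ dominates)

  moves : ∀ {z j} → InColumn j ((as ++ y ∷ bs) ∷ rs) z →
          ∃ λ j' → InColumn j' ((as ++ x ∷ bs) ∷ rs') z × j' ≤ j
                 × (lat ∨ not (length as ≡ᵇ c') ≡ false → j' ≡ j)
  moves {j = j} (here r[j]=z) with j ≟ length as
  ... | yes refl with just-injective (trans (sym r[j]=z) (nth-middle as y bs))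
  ...   | refl = c' , there (lands spec) , c'≤ , λ vertical → sym (not-≡ᵇ≡false⇒≡ (∨-conicalʳ lat _ vertical))
  moves {j = j} (here r[j]=z) | no j≢ = j , here (trans (nth-replace j as x y bs j≢) r[j]=z) , ≤-refl , λ _ → refl
  moves (there z∈rs) =
    let j' , z∈rs' , j'≤j , vertical⇒ = moves-left spec z∈rs
    in j' , there z∈rs' , j'≤j , vertical⇒ ∘ ∨-conicalˡ lat _

  moved : lat ∨ not (length as ≡ᵇ c') ≡ true →
          ∃ λ z → ∃ λ j → ∃ λ j' →
            InColumn j ((as ++ y ∷ bs) ∷ rs) z × InColumn j' ((as ++ x ∷ bs) ∷ rs') z × j' < j
  moved lateral with ∨≡true⇒⊎ lat lateral
  ... | inj₁ lat≡true =
    let z , j , j' , z∈rs , z∈rs' , j'<j = lateral⇒moved spec lat≡true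
    in z , j , j' , there z∈rs , there z∈rs' , j'<j
  ... | inj₂ c'≢ = y , length as , c' , here (nth-middle as y bs) , there (lands spec) ,
                   ≤∧≢⇒< c'≤ (not-≡ᵇ≡true⇒≢ c'≢ ∘ sym)

tabIns-spec : ∀ x T → Increasing T → Unique (concat T) → x ∉ concat T → InsertionSpec T x (tabIns x T)
tabIns-spec x []       _   _    _  = empty-spec x
tabIns-spec x (r ∷ rs) inc uniq x∉ with rowIns x r | rowIns-view x r
... | _ | append r≤x = append-spec x r rs inc (All≤∧∉⇒All< r r≤x (x∉ ∘ ∈-++⁺ˡ))
... | _ | bump as y bs refl as≤x x<y
  with tabIns y rs
     | tabIns-spec y rs (proj₂ (proj₂ inc)) (Unique-++⁻ʳ (as ++ y ∷ bs) uniq)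
                   (Unique-++⇒∉ (as ++ y ∷ bs) uniq (∈-++⁺ʳ as (here refl)))
     | tabIns-bottomRow y rs
...   | ires _ _ _ _ | spec | bottom≡ , land≡ =
  bump-spec as x y bs rs inc (All≤∧∉⇒All< as as≤x (x∉ ∘ ∈-++⁺ˡ ∘ ∈-++⁺ˡ)) x<y bottom≡ land≡ spec

-- The Schensted correspondence

addAt-InColumn : ∀ i k Q {j z} → InColumn j Q z → InColumn j (addAt i k Q) z
addAt-InColumn i zero    (r ∷ rs) (here r[j]=z) = here (trans (nth-++ˡ r [ i ] (nth⇒<length r r[j]=z)) r[j]=z)
addAt-InColumn i zero    (r ∷ rs) (there z∈rs)  = there z∈rs
addAt-InColumn i (suc k) (r ∷ rs) (here r[j]=z) = here r[j]=z
addAt-InColumn i (suc k) (r ∷ rs) (there z∈rs)  = there (addAt-InColumn i k rs z∈rs)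

addAt-new : ∀ i k Q → InColumn (rowLength k (map length Q)) (addAt i k Q) i
addAt-new i k       []       = here refl
addAt-new i zero    (r ∷ rs) = here (nth-middle r i [])
addAt-new i (suc k) (r ∷ rs) = there (addAt-new i k rs)

addAt-↭ : ∀ i k Q → concat (addAt i k Q) ↭ i ∷ concat Q
addAt-↭ i k       []       = ↭-refl
addAt-↭ i zero    (r ∷ rs) = ++-∷ʳ-↭ r i (concat rs)
addAt-↭ i (suc k) (r ∷ rs) = ↭-trans (++⁺ˡ r (addAt-↭ i k rs)) (shift i r (concat rs))

addAt-shape : ∀ i k Q → map length (addAt i k Q) ≡ addBox k (map length Q)
addAt-shape i k       []       = refl
addAt-shape i zero    (r ∷ rs) = cong (_∷ map length rs) (length-∷ʳ r i)
addAt-shape i (suc k) (r ∷ rs) = cong (length r ∷_) (addAt-shape i k rs)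

range1-suc : ∀ n → range1 (suc n) ↭ suc n ∷ range1 n
range1-suc n = begin
  map suc (upTo (suc n))        ≡⟨ cong (map suc) (upTo-∷ʳ n) ⟨
  map suc (upTo n ++ [ n ])     ≡⟨ map-++ suc (upTo n) [ n ] ⟩
  range1 n ++ [ suc n ]         ↭⟨ ∷↭∷ʳ (suc n) (range1 n) ⟨
  suc n ∷ range1 n              ∎
  where open PermutationReasoning

ColumnsAgree : List ℕ → Tableau → Tableau → Set
ColumnsAgree u P Q = ∀ i z → nth i u ≡ just z → ∃ λ j → InColumn j P z × InColumn j Q (suc i)

ColumnsDisagree : List ℕ → Tableau → Tableau → Set
ColumnsDisagree u P Q = ∃ λ i → ∃ λ z → ∃ λ j → ∃ λ j' →
  nth i u ≡ just z × InColumn j P z × InColumn j' Q (suc i) × j < j'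

record RSKInvariant (u : List ℕ) (S : RSKState) : Set where
  field
    steps            : step S ≡ length u
    P-increasing     : Increasing (Pt S)
    P-content        : concat (Pt S) ↭ u
    Q-content        : concat (Qt S) ↭ range1 (length u)
    same-shape       : map length (Pt S) ≡ map length (Qt S)
    vertical⇒agree   : anyLateral S ≡ false → ColumnsAgree u (Pt S) (Qt S)
    lateral⇒disagree : anyLateral S ≡ true → ColumnsDisagree u (Pt S) (Qt S)

open RSKInvariant

rskStep-invariant : ∀ u S x → RSKInvariant u S → Unique u → x ∉ u → RSKInvariant (u ++ [ x ]) (rskStep S x)
rskStep-invariant u (st P Q i lat) x inv uniq x∉u
  with tabIns x P | tabIns-spec x P (P-increasing inv) (Unique-resp-↭ (↭-sym (P-content inv)) uniq)
                                  (x∉u ∘ ∈-resp-↭ (P-content inv))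
... | ires P' c lat' k | spec = record
  { steps            = trans (cong suc (steps inv)) (sym (length-∷ʳ u x))
  ; P-increasing     = increasing spec
  ; P-content        = ↭-trans (content spec) (↭-trans (↭-prep x (P-content inv)) (∷↭∷ʳ x u))
  ; Q-content        = Q-content′
  ; same-shape       = trans (shape spec) (trans (cong (addBox k) (same-shape inv)) (sym (addAt-shape (suc i) k Q)))
  ; vertical⇒agree   = agree
  ; lateral⇒disagree = disagree
  }
  where
  Q' : Tableau
  Q' = addAt (suc i) k Q

  Q-content′ : concat Q' ↭ range1 (length (u ++ [ x ]))
  Q-content′ = begin
    concat Q'                     ↭⟨ addAt-↭ (suc i) k Q ⟩
    suc i ∷ concat Q              ↭⟨ ↭-prep (suc i) (Q-content inv) ⟩
    suc i ∷ range1 (length u)     ≡⟨ cong (λ n → suc n ∷ range1 (length u)) (steps inv) ⟩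
    suc (length u) ∷ range1 (length u) ↭⟨ range1-suc (length u) ⟨
    range1 (suc (length u))       ≡⟨ cong range1 (length-∷ʳ u x) ⟨
    range1 (length (u ++ [ x ]))  ∎
    where open PermutationReasoning

  nth-old : ∀ {i' z} → nth i' u ≡ just z → nth i' (u ++ [ x ]) ≡ just z
  nth-old u[i']=z = trans (nth-++ˡ u [ x ] (nth⇒<length u u[i']=z)) u[i']=z

  -- with vertical bumps only, x lands in the column of the new box of Q
  agree : lat ∨ lat' ≡ false → ColumnsAgree (u ++ [ x ]) P' Q'
  agree vertical i' z u[i']=z with i' ≟ length u
  ... | yes refl with just-injective (trans (sym u[i']=z) (nth-middle u x []))
  ...   | refl = c , lands spec ,
    subst₂ (λ a b → InColumn b Q' (suc a)) (steps inv)
      (sym (trans (vertical⇒lands-in-new-box spec (∨-conicalʳ lat _ vertical)) (cong (rowLength k) (same-shape inv))))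
      (addAt-new (suc i) k Q)
  agree vertical i' z u[i']=z | no i'≢ =
    let j , z∈P , i'∈Q = vertical⇒agree inv (∨-conicalˡ lat _ vertical) i' z (trans (sym (nth-∷ʳ i' u x i'≢)) u[i']=z)
        j' , z∈P' , _ , vertical⇒j'≡j = moves-left spec z∈P
    in j , subst (λ j → InColumn j P' z) (vertical⇒j'≡j (∨-conicalʳ lat _ vertical)) z∈P'
         , addAt-InColumn (suc i) k Q i'∈Q

  -- entries of P only move left, so an old disagreement persists, and a new
  -- lateral bump moves an entry left of the column where it agreed with Q
  disagree : lat ∨ lat' ≡ true → ColumnsDisagree (u ++ [ x ]) P' Q'
  disagree lateral with lat ≟ᵇ true
  ... | yes lat≡ =
    let i' , z , j , j' , u[i']=z , z∈P , i'∈Q , j<j' = lateral⇒disagree inv lat≡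
        j'' , z∈P' , j''≤j , _ = moves-left spec z∈P
    in i' , z , j'' , j' , nth-old u[i']=z , z∈P' , addAt-InColumn (suc i) k Q i'∈Q , ≤-<-trans j''≤j j<j'
  ... | no lat≢ =
    let lat≡ = ¬-not lat≢
        z , j , j' , z∈P , z∈P' , j'<j = lateral⇒moved spec (subst (λ b → b ∨ lat' ≡ true) lat≡ lateral)
        i' , u[i']=z = ∈⇒nth u (∈-resp-↭ (P-content inv) (InColumn⇒∈ z∈P))
        j₀ , z∈P₀ , i'∈Q = vertical⇒agree inv lat≡ i' z u[i']=z
        j₀≡j = InColumn-unique (Unique-resp-↭ (↭-sym (P-content inv)) uniq) z∈P₀ z∈P
    in i' , z , j' , j , nth-old u[i']=z , z∈P' ,
       addAt-InColumn (suc i) k Q (subst (λ j → InColumn j Q (suc i')) j₀≡j i'∈Q) , j'<j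

foldl-rskStep-invariant : ∀ u v S → RSKInvariant u S → Unique (u ++ v) →
                          RSKInvariant (u ++ v) (L.foldl rskStep S v)
foldl-rskStep-invariant u []      S inv uniq = subst (λ u → RSKInvariant u S) (sym (++-identityʳ u)) inv
foldl-rskStep-invariant u (x ∷ v) S inv uniq =
  subst (λ u → RSKInvariant u (L.foldl rskStep (rskStep S x) v)) (++-assoc u [ x ] v)
    (foldl-rskStep-invariant (u ++ [ x ]) v (rskStep S x)
      (rskStep-invariant u S x inv (Unique-++⁻ˡ u uniq) (λ x∈u → Unique-++⇒∉ u uniq x∈u (here refl)))
      (subst Unique (sym (++-assoc u [ x ] v)) uniq))

rsk-invariant : ∀ w → Unique w → RSKInvariant w (rsk w)
rsk-invariant w = foldl-rskStep-invariant [] w (st [] [] 0 false) record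
  { steps            = refl
  ; P-increasing     = tt
  ; P-content        = ↭-refl
  ; Q-content        = ↭-refl
  ; same-shape       = refl
  ; vertical⇒agree   = λ _ _ _ ()
  ; lateral⇒disagree = λ ()
  }

column-∷ : ∀ j r rs → column j (r ∷ rs) ≡ L.fromMaybe (nth j r) ++ column j rs
column-∷ j r rs with nth j r
... | just _  = refl
... | nothing = refl

concatMap-++-↭ : ∀ (f g : ℕ → List ℕ) js →
                 L.concatMap (λ j → f j ++ g j) js ↭ L.concatMap f js ++ L.concatMap g js
concatMap-++-↭ f g []       = ↭-refl
concatMap-++-↭ f g (j ∷ js) = begin
  (f j ++ g j) ++ L.concatMap (λ j → f j ++ g j) js   ↭⟨ ++⁺ˡ (f j ++ g j) (concatMap-++-↭ f g js) ⟩
  (f j ++ g j) ++ L.concatMap f js ++ L.concatMap g js ≡⟨ ++-assoc (f j) (g j) _ ⟩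
  f j ++ g j ++ L.concatMap f js ++ L.concatMap g js   ↭⟨ ++⁺ˡ (f j) (shifts (g j) (L.concatMap f js)) ⟩
  f j ++ L.concatMap f js ++ g j ++ L.concatMap g js   ≡⟨ ++-assoc (f j) (L.concatMap f js) _ ⟨
  (f j ++ L.concatMap f js) ++ g j ++ L.concatMap g js ∎
  where open PermutationReasoning

concat-applyUpTo-[] : ∀ N → concat (L.applyUpTo (λ _ → List ℕ ∋ []) N) ≡ []
concat-applyUpTo-[] zero    = refl
concat-applyUpTo-[] (suc N) = concat-applyUpTo-[] N

concat-applyUpTo-row : ∀ (r : List ℕ) N → length r ≤ N → concat (L.applyUpTo (λ j → L.fromMaybe (nth j r)) N) ≡ r
concat-applyUpTo-row []      N       _         = concat-applyUpTo-[] N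
concat-applyUpTo-row (a ∷ r) (suc N) (s≤s len≤) = cong (a ∷_) (concat-applyUpTo-row r N len≤)

concat-columns-↭ : ∀ T N → All (λ r → length r ≤ N) T → L.concatMap (λ j → column j T) (upTo N) ↭ concat T
concat-columns-↭ []       N _ = ↭-reflexive (trans (cong concat (map-upTo (λ _ → []) N)) (concat-applyUpTo-[] N))
concat-columns-↭ (r ∷ rs) N (len≤ ∷ lens≤) = begin
  L.concatMap (λ j → column j (r ∷ rs)) (upTo N)
    ≡⟨ concatMap-cong (λ j → column-∷ j r rs) (upTo N) ⟩
  L.concatMap (λ j → L.fromMaybe (nth j r) ++ column j rs) (upTo N)
    ↭⟨ concatMap-++-↭ (λ j → L.fromMaybe (nth j r)) (λ j → column j rs) (upTo N) ⟩
  L.concatMap (λ j → L.fromMaybe (nth j r)) (upTo N) ++ L.concatMap (λ j → column j rs) (upTo N)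
    ≡⟨ cong (_++ _) (trans (cong concat (map-upTo (λ j → L.fromMaybe (nth j r)) N)) (concat-applyUpTo-row r N len≤)) ⟩
  r ++ L.concatMap (λ j → column j rs) (upTo N)
    ↭⟨ ++⁺ˡ r (concat-columns-↭ rs N lens≤) ⟩
  r ++ concat rs ∎
  where open PermutationReasoning

column⇒InColumn : ∀ j T {z} → z ∈ column j T → InColumn j T z
column⇒InColumn j (r ∷ rs) z∈ with nth j r in r[j]
... | just _ with z∈
...   | here refl = here r[j]
...   | there z∈′ = there (column⇒InColumn j rs z∈′)
column⇒InColumn j (r ∷ rs) z∈ | nothing = there (column⇒InColumn j rs z∈)

InColumn⇒column : ∀ j T {z} → InColumn j T z → z ∈ column j T
InColumn⇒column j (r ∷ rs) (here r[j]=z) with nth j r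
InColumn⇒column j (r ∷ rs) (here refl) | just _ = here refl
InColumn⇒column j (r ∷ rs) (there z∈rs) with nth j r
... | just _  = there (InColumn⇒column j rs z∈rs)
... | nothing = InColumn⇒column j rs z∈rs

column⇒∈ : ∀ j T {z} → z ∈ column j T → z ∈ concat T
column⇒∈ j T = InColumn⇒∈ ∘ column⇒InColumn j T

Unique-column : ∀ j T → Unique (concat T) → Unique (column j T)
Unique-column j []       _    = []
Unique-column j (r ∷ rs) uniq with nth j r in r[j]
... | just x  = All.tabulate (λ z∈ x≡z → Unique-++⇒∉ r uniq (nth⇒∈ r r[j])
                                          (subst (_∈ concat rs) (sym x≡z) (column⇒∈ j rs z∈)))
              ∷ Unique-column j rs (Unique-++⁻ʳ r uniq)
... | nothing = Unique-column j rs (Unique-++⁻ʳ r uniq)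

length-column : ∀ j T T' → map length T ≡ map length T' → length (column j T) ≡ length (column j T')
length-column j []       []         _     = refl
length-column j (r ∷ rs) (r' ∷ rs') shape≡ with ∷-injective shape≡
... | len≡ , shapes≡ with nth j r in r[j] | nth j r' in r'[j]
...   | just _  | just _  = cong suc (length-column j rs rs' shapes≡)
...   | nothing | nothing = length-column j rs rs' shapes≡
...   | just _  | nothing =
  ⊥-elim (<⇒≱ (subst (j <_) len≡ (nth⇒<length r r[j])) (nth≡nothing⇒length≤ j r' r'[j]))
...   | nothing | just _  =
  ⊥-elim (<⇒≱ (subst (j <_) (sym len≡) (nth⇒<length r' r'[j])) (nth≡nothing⇒length≤ j r r[j]))

-- Coefficients of expanded polynomials

select : Bool → ℤ → ℤ
select b s = if b then s else + 0

coeffWhere : {A : Set} → (A → Bool) → List (ℤ × A) → ℤ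
coeffWhere f = L.foldr (λ t acc → select (f (proj₂ t)) (proj₁ t) + acc) (+ 0)

module _ {A : Set} where

  coeffWhere-cong : (f g : A → Bool) (ts : List (ℤ × A)) → (∀ {t} → t ∈ ts → f (proj₂ t) ≡ g (proj₂ t)) →
                    coeffWhere f ts ≡ coeffWhere g ts
  coeffWhere-cong f g []       _   = refl
  coeffWhere-cong f g (t ∷ ts) f≗g =
    cong₂ (λ b acc → select b (proj₁ t) + acc) (f≗g (here refl)) (coeffWhere-cong f g ts (f≗g ∘ there))

  coeffWhere-none : (f : A → Bool) (ts : List (ℤ × A)) → (∀ {t} → t ∈ ts → f (proj₂ t) ≡ false) →
                    coeffWhere f ts ≡ + 0
  coeffWhere-none f []       _    = refl
  coeffWhere-none f (t ∷ ts) none rewrite none (here refl) =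
    trans (ℤ.+-identityˡ _) (coeffWhere-none f ts (none ∘ there))

  coeffWhere-∧ˡ : ∀ b (g : A → Bool) (ts : List (ℤ × A)) →
                  coeffWhere (λ a → b ∧ g a) ts ≡ select b (coeffWhere g ts)
  coeffWhere-∧ˡ true  g ts = refl
  coeffWhere-∧ˡ false g ts = coeffWhere-none _ ts (λ _ → refl)

  coeffWhere-++ : (f : A → Bool) (xs ys : List (ℤ × A)) →
                  coeffWhere f (xs ++ ys) ≡ coeffWhere f xs + coeffWhere f ys
  coeffWhere-++ f []       ys = sym (ℤ.+-identityˡ _)
  coeffWhere-++ f (x ∷ xs) ys =
    trans (cong (_+_ (select (f (proj₂ x)) (proj₁ x))) (coeffWhere-++ f xs ys))
          (sym (ℤ.+-assoc (select (f (proj₂ x)) (proj₁ x)) (coeffWhere f xs) (coeffWhere f ys)))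

  coeffWhere-concatMap : {B : Set} (f : A → Bool) (h : B → List (ℤ × A)) (bs : List B) →
    coeffWhere f (L.concatMap h bs) ≡ L.foldr (λ b acc → coeffWhere f (h b) + acc) (+ 0) bs
  coeffWhere-concatMap f h []       = refl
  coeffWhere-concatMap f h (b ∷ bs) =
    trans (coeffWhere-++ f (h b) (L.concatMap h bs)) (cong (_+_ (coeffWhere f (h b))) (coeffWhere-concatMap f h bs))

  coeffWhere-relabel : {B : Set} (f : B → Bool) (h : A → B) (ts : List (ℤ × A)) →
                       coeffWhere f (map (λ t → proj₁ t , h (proj₂ t)) ts) ≡ coeffWhere (f ∘ h) ts
  coeffWhere-relabel f h []       = refl
  coeffWhere-relabel f h (t ∷ ts) = cong (_+_ (select (f (h (proj₂ t))) (proj₁ t))) (coeffWhere-relabel f h ts)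

  coeffWhere-scale : (f : A → Bool) (c : ℤ) (ts : List (ℤ × A)) →
                     coeffWhere f (map (λ t → c * proj₁ t , proj₂ t) ts) ≡ c * coeffWhere f ts
  coeffWhere-scale f c []       = sym (ℤ.*-zeroʳ c)
  coeffWhere-scale f c (t ∷ ts) =
    trans (cong₂ _+_ (select-* (f (proj₂ t))) (coeffWhere-scale f c ts)) (sym (ℤ.*-distribˡ-+ c _ _))
    where
    select-* : ∀ b → select b (c * proj₁ t) ≡ c * select b (proj₁ t)
    select-* false = sym (ℤ.*-zeroʳ c)
    select-* true  = refl

  coeffWhere-negate : (f : A → Bool) (h : A → A) (ts : List (ℤ × A)) →
                      coeffWhere f (map (λ t → - proj₁ t , h (proj₂ t)) ts) ≡ - coeffWhere (f ∘ h) ts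
  coeffWhere-negate f h []       = refl
  coeffWhere-negate f h (t ∷ ts) =
    trans (cong₂ _+_ (select-neg (f (h (proj₂ t)))) (coeffWhere-negate f h ts))
          (sym (ℤ.neg-distrib-+ (select (f (h (proj₂ t))) (proj₁ t)) (coeffWhere (f ∘ h) ts)))
    where
    select-neg : ∀ b → select b (- proj₁ t) ≡ - select b (proj₁ t)
    select-neg false = refl
    select-neg true  = refl

select-∧-* : ∀ a b (s u : ℤ) → select (a ∧ b) (s * u) ≡ select a s * select b u
select-∧-* false b    s u = refl
select-∧-* true false s u = sym (ℤ.*-zeroʳ s)
select-∧-* true true  s u = refl

module _ (f : Monomial → Bool) (f-++ : ∀ m m' → f (m ++ m') ≡ f m ∧ f m') where

  coeffWhere-monomial-* : ∀ (s : ℤ) m (G : List (ℤ × Monomial)) →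
    coeffWhere f (map (λ b → s * proj₁ b , m ++ proj₂ b) G) ≡ select (f m) s * coeffWhere f G
  coeffWhere-monomial-* s m []      = sym (ℤ.*-zeroʳ (select (f m) s))
  coeffWhere-monomial-* s m (b ∷ G) =
    trans (cong₂ _+_ (trans (cong (λ c → select c (s * proj₁ b)) (f-++ m (proj₂ b)))
                              (select-∧-* (f m) (f (proj₂ b)) s (proj₁ b)))
                       (coeffWhere-monomial-* s m G))
          (sym (ℤ.*-distribˡ-+ (select (f m) s) _ _))

  coeffWhere-mulTerms : ∀ F G → coeffWhere f (mulTerms F G) ≡ coeffWhere f F * coeffWhere f G
  coeffWhere-mulTerms []      G = refl
  coeffWhere-mulTerms (a ∷ F) G = begin
    coeffWhere f (map (λ b → proj₁ a * proj₁ b , proj₂ a ++ proj₂ b) G ++ mulTerms F G)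
      ≡⟨ coeffWhere-++ f (map (λ b → proj₁ a * proj₁ b , proj₂ a ++ proj₂ b) G) (mulTerms F G) ⟩
    coeffWhere f (map (λ b → proj₁ a * proj₁ b , proj₂ a ++ proj₂ b) G) + coeffWhere f (mulTerms F G)
      ≡⟨ cong₂ _+_ (coeffWhere-monomial-* (proj₁ a) (proj₂ a) G) (coeffWhere-mulTerms F G) ⟩
    select (f (proj₂ a)) (proj₁ a) * coeffWhere f G + coeffWhere f F * coeffWhere f G
      ≡⟨ ℤ.*-distribʳ-+ (coeffWhere f G) (select (f (proj₂ a)) (proj₁ a)) (coeffWhere f F) ⟨
    coeffWhere f (a ∷ F) * coeffWhere f G ∎
    where open ≡-Reasoning

insAll-↭ : ∀ y (xs : List ℕ) {t} → t ∈ insAll y xs → proj₂ t ↭ y ∷ xs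
insAll-↭ y []       (here refl) = ↭-refl
insAll-↭ y (x ∷ xs) (here refl) = ↭-refl
insAll-↭ y (x ∷ xs) (there t∈) with ∈-map⁻ _ t∈
... | t' , t'∈ , refl = ↭-trans (↭-prep x (insAll-↭ y xs t'∈)) (↭-swap x y ↭-refl)

signedPerms-↭ : ∀ (qs : List ℕ) {t} → t ∈ signedPerms qs → proj₂ t ↭ qs
signedPerms-↭ []       (here refl) = ↭-refl
signedPerms-↭ (y ∷ ys) t∈ with find (∈-concatMap⁻ _ {xs = signedPerms ys} t∈)
... | p , p∈ , t∈p with ∈-map⁻ _ t∈p
...   | q , q∈ , refl = ↭-trans (insAll-↭ y (proj₂ p) q∈) (↭-prep y (signedPerms-↭ ys p∈))

sameList : List ℕ → List ℕ → Bool
sameList []       []       = true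
sameList []       (_ ∷ _)  = false
sameList (_ ∷ _)  []       = false
sameList (a ∷ as) (b ∷ bs) = (a ≡ᵇ b) ∧ sameList as bs

sameList≡true⇒≡ : ∀ xs ys → sameList xs ys ≡ true → xs ≡ ys
sameList≡true⇒≡ []       []       _  = refl
sameList≡true⇒≡ (a ∷ as) (b ∷ bs) eq with a ≡ᵇ b in a≡ᵇb
... | true = cong₂ _∷_ (≡ᵇ≡true⇒≡ a≡ᵇb) (sameList≡true⇒≡ as bs eq)

−1^ : ℕ → ℤ
−1^ zero    = + 1
−1^ (suc k) = - −1^ k

IsSign : ℤ → Set
IsSign z = z ≡ + 1 ⊎ z ≡ - + 1

IsSign-neg : ∀ {z} → IsSign z → IsSign (- z)
IsSign-neg (inj₁ refl) = inj₂ refl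
IsSign-neg (inj₂ refl) = inj₁ refl

IsSign-* : ∀ {a b} → IsSign a → IsSign b → IsSign (a * b)
IsSign-* (inj₁ refl) (inj₁ refl) = inj₁ refl
IsSign-* (inj₁ refl) (inj₂ refl) = inj₂ refl
IsSign-* (inj₂ refl) (inj₁ refl) = inj₂ refl
IsSign-* (inj₂ refl) (inj₂ refl) = inj₁ refl

IsSign-−1^ : ∀ k → IsSign (−1^ k)
IsSign-−1^ zero    = inj₁ refl
IsSign-−1^ (suc k) = IsSign-neg (IsSign-−1^ k)

IsSign⇒nonzero : ∀ {z} → IsSign z → isZeroℤ z ≡ false
IsSign⇒nonzero (inj₁ refl) = refl
IsSign⇒nonzero (inj₂ refl) = refl

-- Inserting y into π produces as ++ y ∷ bs exactly once, namely at position
-- length as when π is as ++ bs.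
coeffWhere-insAll : ∀ y (as bs π : List ℕ) → y ∉ π → y ∉ as →
  coeffWhere (λ ρ → sameList ρ (as ++ y ∷ bs)) (insAll y π) ≡ −1^ (length as) * select (sameList π (as ++ bs)) (+ 1)
coeffWhere-insAll y [] bs [] _ _ rewrite ≡⇒≡ᵇ≡true {y} refl =
  trans (ℤ.+-identityʳ _) (sym (ℤ.*-identityˡ _))
coeffWhere-insAll y [] bs (x ∷ xs) y∉ _ = begin
  select ((y ≡ᵇ y) ∧ sameList (x ∷ xs) bs) (+ 1)
    + coeffWhere (λ ρ → sameList ρ (y ∷ bs)) (map (λ t → - proj₁ t , x ∷ proj₂ t) (insAll y xs))
    ≡⟨ cong₂ _+_ (cong (λ b → select (b ∧ sameList (x ∷ xs) bs) (+ 1)) (≡⇒≡ᵇ≡true {y} refl))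
                 (coeffWhere-negate (λ ρ → sameList ρ (y ∷ bs)) (x ∷_) (insAll y xs)) ⟩
  select (sameList (x ∷ xs) bs) (+ 1) + - coeffWhere (λ ρ → (x ≡ᵇ y) ∧ sameList ρ bs) (insAll y xs)
    ≡⟨ cong (λ c → select (sameList (x ∷ xs) bs) (+ 1) + - c)
            (trans (coeffWhere-∧ˡ (x ≡ᵇ y) (λ ρ → sameList ρ bs) (insAll y xs))
                   (cong (λ b → select b (coeffWhere (λ ρ → sameList ρ bs) (insAll y xs)))
                         (≢⇒≡ᵇ≡false (λ x≡y → y∉ (here (sym x≡y)))))) ⟩
  select (sameList (x ∷ xs) bs) (+ 1) + + 0
    ≡⟨ ℤ.+-identityʳ _ ⟩
  select (sameList (x ∷ xs) bs) (+ 1)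
    ≡⟨ ℤ.*-identityˡ _ ⟨
  + 1 * select (sameList (x ∷ xs) bs) (+ 1) ∎
  where open ≡-Reasoning
coeffWhere-insAll y (a ∷ as) bs [] _ y∉as rewrite ≢⇒≡ᵇ≡false (y∉as ∘ here) =
  sym (ℤ.*-zeroʳ (−1^ (suc (length as))))
coeffWhere-insAll y (a ∷ as) bs (x ∷ xs) y∉ y∉as rewrite ≢⇒≡ᵇ≡false (y∉as ∘ here) = begin
  + 0 + coeffWhere (λ ρ → sameList ρ (a ∷ as ++ y ∷ bs)) (map (λ t → - proj₁ t , x ∷ proj₂ t) (insAll y xs))
    ≡⟨ trans (ℤ.+-identityˡ _) (coeffWhere-negate (λ ρ → sameList ρ (a ∷ as ++ y ∷ bs)) (x ∷_) (insAll y xs)) ⟩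
  - coeffWhere (λ ρ → (x ≡ᵇ a) ∧ sameList ρ (as ++ y ∷ bs)) (insAll y xs)
    ≡⟨ cong -_ (coeffWhere-∧ˡ (x ≡ᵇ a) (λ ρ → sameList ρ (as ++ y ∷ bs)) (insAll y xs)) ⟩
  - select (x ≡ᵇ a) (coeffWhere (λ ρ → sameList ρ (as ++ y ∷ bs)) (insAll y xs))
    ≡⟨ cong (λ c → - select (x ≡ᵇ a) c) (coeffWhere-insAll y as bs xs (y∉ ∘ there) (y∉as ∘ there)) ⟩
  - select (x ≡ᵇ a) (−1^ (length as) * select (sameList xs (as ++ bs)) (+ 1))
    ≡⟨ negate-select (x ≡ᵇ a) ⟩
  - −1^ (length as) * select ((x ≡ᵇ a) ∧ sameList xs (as ++ bs)) (+ 1) ∎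
  where
  open ≡-Reasoning
  negate-select : ∀ b → - select b (−1^ (length as) * select (sameList xs (as ++ bs)) (+ 1))
                      ≡ - −1^ (length as) * select (b ∧ sameList xs (as ++ bs)) (+ 1)
  negate-select true  = ℤ.neg-distribˡ-* (−1^ (length as)) (select (sameList xs (as ++ bs)) (+ 1))
  negate-select false = sym (ℤ.*-zeroʳ (- −1^ (length as)))

coeffWhere-signedPerms-∷ : ∀ y (ys as bs : List ℕ) → y ∉ ys → y ∉ as →
  coeffWhere (λ π → sameList π (as ++ y ∷ bs)) (signedPerms (y ∷ ys))
    ≡ −1^ (length as) * coeffWhere (λ π → sameList π (as ++ bs)) (signedPerms ys)
coeffWhere-signedPerms-∷ y ys as bs y∉ys y∉as =
  trans (coeffWhere-concatMap is-τ (λ p → insertWithSign p) (signedPerms ys))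
        (go (signedPerms ys) (λ p∈ → y∉ys ∘ ∈-resp-↭ (signedPerms-↭ ys p∈)))
  where
  is-τ is-τ⁻ : List ℕ → Bool
  is-τ  π = sameList π (as ++ y ∷ bs)
  is-τ⁻ π = sameList π (as ++ bs)

  s : ℤ
  s = −1^ (length as)

  insertWithSign : ℤ × List ℕ → List (ℤ × List ℕ)
  insertWithSign p = map (λ q → proj₁ p * proj₁ q , proj₂ q) (insAll y (proj₂ p))

  scale-select : ∀ b (c : ℤ) → c * (s * select b (+ 1)) ≡ s * select b c
  scale-select false c = trans (cong (c *_) (ℤ.*-zeroʳ s)) (trans (ℤ.*-zeroʳ c) (sym (ℤ.*-zeroʳ s)))
  scale-select true  c = trans (cong (c *_) (ℤ.*-identityʳ s)) (ℤ.*-comm c s)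

  go : ∀ ps → (∀ {p} → p ∈ ps → y ∉ proj₂ p) →
       L.foldr (λ p acc → coeffWhere is-τ (insertWithSign p) + acc) (+ 0) ps ≡ s * coeffWhere is-τ⁻ ps
  go []       _  = sym (ℤ.*-zeroʳ s)
  go (p ∷ ps) y∉ = begin
    coeffWhere is-τ (insertWithSign p) + L.foldr (λ p acc → coeffWhere is-τ (insertWithSign p) + acc) (+ 0) ps
      ≡⟨ cong₂ _+_ (coeffWhere-scale is-τ (proj₁ p) (insAll y (proj₂ p))) (go ps (y∉ ∘ there)) ⟩
    proj₁ p * coeffWhere is-τ (insAll y (proj₂ p)) + s * coeffWhere is-τ⁻ ps
      ≡⟨ cong (λ c → proj₁ p * c + s * coeffWhere is-τ⁻ ps)
              (coeffWhere-insAll y as bs (proj₂ p) (y∉ (here refl)) y∉as) ⟩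
    proj₁ p * (s * select (is-τ⁻ (proj₂ p)) (+ 1)) + s * coeffWhere is-τ⁻ ps
      ≡⟨ cong (_+ s * coeffWhere is-τ⁻ ps) (scale-select (is-τ⁻ (proj₂ p)) (proj₁ p)) ⟩
    s * select (is-τ⁻ (proj₂ p)) (proj₁ p) + s * coeffWhere is-τ⁻ ps
      ≡⟨ ℤ.*-distribˡ-+ s (select (is-τ⁻ (proj₂ p)) (proj₁ p)) (coeffWhere is-τ⁻ ps) ⟨
    s * coeffWhere is-τ⁻ (p ∷ ps) ∎
    where open ≡-Reasoning

signedPerms-coeff-IsSign : ∀ qs τ → Unique qs → τ ↭ qs →
                           IsSign (coeffWhere (λ π → sameList π τ) (signedPerms qs))
signedPerms-coeff-IsSign [] τ _ τ↭[] with ↭-empty-inv τ↭[]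
... | refl = inj₁ refl
signedPerms-coeff-IsSign (y ∷ ys) τ (y∉ys ∷ uniq) τ↭ with ∈-∃++ (∈-resp-↭ (↭-sym τ↭) (here refl))
... | as , bs , refl =
  subst IsSign (sym (coeffWhere-signedPerms-∷ y ys as bs (λ y∈ys → All.lookup y∉ys y∈ys refl) y∉as))
    (IsSign-* (IsSign-−1^ (length as)) (signedPerms-coeff-IsSign ys (as ++ bs) uniq (drop-mid as [] τ↭)))
  where
  y∉as : y ∉ as
  y∉as y∈as = Unique-++⇒∉ as (Unique-resp-↭ (↭-sym τ↭) (y∉ys ∷ uniq)) y∈as (here refl)

signedPerms-coeff-≁ : ∀ qs τ → ¬ (τ ↭ qs) → coeffWhere (λ π → sameList π τ) (signedPerms qs) ≡ + 0
signedPerms-coeff-≁ qs τ τ≁qs = coeffWhere-none _ (signedPerms qs) not-τ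
  where
  not-τ : ∀ {t} → t ∈ signedPerms qs → sameList (proj₂ t) τ ≡ false
  not-τ {t} t∈ with sameList (proj₂ t) τ in same
  ... | false = refl
  ... | true  = ⊥-elim (τ≁qs (subst (_↭ qs) (sameList≡true⇒≡ _ _ same) (signedPerms-↭ qs t∈)))

∏ : (ℕ → ℤ) → List ℕ → ℤ
∏ f = L.foldr (λ j acc → f j * acc) (+ 1)

IsSign-∏ : ∀ f js → (∀ {j} → j ∈ js → IsSign (f j)) → IsSign (∏ f js)
IsSign-∏ f []       _      = inj₁ refl
IsSign-∏ f (j ∷ js) signs = IsSign-* (signs (here refl)) (IsSign-∏ f js (signs ∘ there))

∏-zero : ∀ f js {j} → j ∈ js → f j ≡ + 0 → ∏ f js ≡ + 0
∏-zero f (j ∷ js) (here refl) fj≡0 rewrite fj≡0 = refl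
∏-zero f (i ∷ js) (there j∈)  fj≡0 = trans (cong (f i *_) (∏-zero f js j∈ fj≡0)) (ℤ.*-zeroʳ (f i))

Unique-range1 : ∀ n → Unique (range1 n)
Unique-range1 n = Unique.map⁺ suc-injective (Unique.upTo⁺ n)

length-range1 : ∀ n → length (range1 n) ≡ n
length-range1 n = trans (length-map suc (upTo n)) (length-upTo n)

∈-range1⁻ : ∀ {n q} → q ∈ range1 n → ∃ λ i → q ≡ suc i × i < n
∈-range1⁻ q∈ with ∈-map⁻ suc q∈
... | i , i∈ , refl = i , refl , ∈-upTo⁻ i∈

expo-∈ : ∀ a b (m : Monomial) → (a , b) ∈ m → 1 ≤ expo a b m
expo-∈ a b ((c , d) ∷ m) (here refl) rewrite ≡⇒≡ᵇ≡true {a} refl | ≡⇒≡ᵇ≡true {b} refl = s≤s z≤n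
expo-∈ a b ((c , d) ∷ m) (there ab∈) = ≤-trans (expo-∈ a b m ab∈) (m≤n+m _ _)

expo-∉ : ∀ a b (m : Monomial) → b ∉ map proj₂ m → expo a b m ≡ 0
expo-∉ a b []            _  = refl
expo-∉ a b ((c , d) ∷ m) b∉ rewrite ≢⇒≡ᵇ≡false {d} {b} (b∉ ∘ here ∘ sym) | ∧-zeroʳ (c ≡ᵇ a) =
  expo-∉ a b m (b∉ ∘ there)

matEntry-just : ∀ w {x} a b → nth (ℕ.pred b) w ≡ just x → matEntry w a b ≡ (if x ≡ᵇ a then 1 else 0)
matEntry-just w a b w[b] with nth (ℕ.pred b) w
matEntry-just w a b refl | just x = refl

matEntry-0∨1 : ∀ w a b → matEntry w a b ≡ 0 ⊎ matEntry w a b ≡ 1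
matEntry-0∨1 w a b with nth (ℕ.pred b) w
... | nothing = inj₁ refl
... | just x with x ≡ᵇ a
...   | true  = inj₂ refl
...   | false = inj₁ refl

matEntry-column : ∀ w a c b → matEntry w c b ≡ 1 → matEntry w a b ≡ (if c ≡ᵇ a then 1 else 0)
matEntry-column w a c b α[c,b]=1 with nth (ℕ.pred b) w
... | just x with x ≡ᵇ c in x≡ᵇc
...   | true with ≡ᵇ≡true⇒≡ {x} {c} x≡ᵇc
...     | refl = refl
matEntry-column w a c b () | just x | false
matEntry-column w a c b () | nothing

isEntry : List ℕ → ℕ × ℕ → Bool
isEntry w (p , q) = matEntry w p q ≡ᵇ 1

expo≡matEntry : ∀ w a b (m : Monomial) → Unique (map proj₂ m) → b ∈ map proj₂ m →
                All (λ pq → isEntry w pq ≡ true) m → expo a b m ≡ matEntry w a b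
expo≡matEntry w a b ((c , d) ∷ m) (d∉ ∷ _) _ (α[c,d]=1 ∷ _) with d ≟ b
... | yes refl rewrite ≡⇒≡ᵇ≡true {d} refl | ∧-identityʳ (c ≡ᵇ a)
                     | expo-∉ a d m (λ d∈ → All.lookup d∉ d∈ refl)
                     | matEntry-column w a c d (≡ᵇ≡true⇒≡ α[c,d]=1) with c ≡ᵇ a
...   | true  = refl
...   | false = refl
expo≡matEntry w a b ((c , d) ∷ m) _ (here b≡d) _ | no d≢b = ⊥-elim (d≢b (sym b≡d))
expo≡matEntry w a b ((c , d) ∷ m) (_ ∷ uniq) (there b∈) (_ ∷ entries) | no d≢b
  rewrite ≢⇒≡ᵇ≡false d≢b | ∧-zeroʳ (c ≡ᵇ a) = expo≡matEntry w a b m uniq b∈ entries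

∈-mulTerms⁻ : ∀ F G {t} → t ∈ mulTerms F G →
              ∃ λ a → ∃ λ b → a ∈ F × b ∈ G × proj₂ t ≡ proj₂ a ++ proj₂ b
∈-mulTerms⁻ F G t∈ with find (∈-concatMap⁻ _ {xs = F} t∈)
... | a , a∈ , t∈a with ∈-map⁻ _ t∈a
...   | b , b∈ , refl = a , b , a∈ , b∈ , refl

∈-detTerms⁻ : ∀ ps qs {t} → t ∈ detTerms ps qs →
              ∃ λ s → s ∈ signedPerms qs × proj₂ t ≡ L.zipWith _,_ ps (proj₂ s)
∈-detTerms⁻ ps qs t∈ with ∈-map⁻ _ t∈
... | s , s∈ , refl = s , s∈ , refl

map-proj₂-zip : ∀ (ps π : List ℕ) → length ps ≡ length π → map proj₂ (L.zipWith _,_ ps π) ≡ π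
map-proj₂-zip []       []      _     = refl
map-proj₂-zip (p ∷ ps) (q ∷ π) len≡ = cong (q ∷_) (map-proj₂-zip ps π (suc-injective len≡))

∈-zip⁻ : ∀ (ps π : List ℕ) {pq} → pq ∈ L.zipWith _,_ ps π → proj₁ pq ∈ ps × proj₂ pq ∈ π
∈-zip⁻ (p ∷ ps) (q ∷ π) (here refl) = here refl , here refl
∈-zip⁻ (p ∷ ps) (q ∷ π) (there pq∈) = let p∈ , q∈ = ∈-zip⁻ ps π pq∈ in there p∈ , there q∈

-- The coefficient of z^α in [P_α | Q_α]

module _ (w : List ℕ) (w↭ : w ↭ range1 (length w)) where

  private
    R : List ℕ
    R = range1 (length w)

    P Q : Tableau
    P = Ptab w
    Q = Qtab w

  Unique-w : Unique w
  Unique-w = Unique-resp-↭ (↭-sym w↭) (Unique-range1 (length w))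

  allEntries : Monomial → Bool
  allEntries = allB (isEntry w)

  isZAlpha≡allEntries : ∀ (m : Monomial) → All (λ pq → proj₁ pq ∈ R × proj₂ pq ∈ R) m → map proj₂ m ↭ R →
                        isZAlpha w m ≡ allEntries m
  isZAlpha≡allEntries m m⊆R×R m↭R = ≡true⇔⇒≡ zα⇒entries entries⇒zα
    where
    zα⇒entries : isZAlpha w m ≡ true → allEntries m ≡ true
    zα⇒entries zα = All⇒allB (isEntry w) m (All.tabulate entry)
      where
      exponents : All (λ a → allB (λ b → expo a b m ≡ᵇ matEntry w a b) R ≡ true) R
      exponents = allB⇒All _ R (∧-conicalˡ _ _ zα)
      entry : ∀ {pq} → pq ∈ m → isEntry w pq ≡ true
      entry {p , q} pq∈ with All.lookup m⊆R×R pq∈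
      ... | p∈ , q∈ with matEntry-0∨1 w p q | ≡ᵇ≡true⇒≡ (All.lookup (allB⇒All _ R (All.lookup exponents p∈)) q∈)
      ...   | inj₂ α[p,q]=1 | _     = ≡⇒≡ᵇ≡true α[p,q]=1
      ...   | inj₁ α[p,q]=0 | expo≡ with () ← subst (1 ≤_) (trans expo≡ α[p,q]=0) (expo-∈ p q m pq∈)

    entries⇒zα : allEntries m ≡ true → isZAlpha w m ≡ true
    entries⇒zα entries = cong₂ _∧_
      (All⇒allB _ R (All.tabulate λ {a} _ → All⇒allB _ R (All.tabulate λ {b} b∈ →
         ≡⇒≡ᵇ≡true (expo≡matEntry w a b m (Unique-resp-↭ (↭-sym m↭R) (Unique-range1 (length w)))
                                            (∈-resp-↭ (↭-sym m↭R) b∈) (allB⇒All _ m entries)))))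
      (≡⇒≡ᵇ≡true (trans (sym (length-map proj₂ m)) (trans (↭-length m↭R) (length-range1 (length w)))))

  w⁻¹ : ℕ → ℕ
  w⁻¹ p = suc (position p w)

  w⁻¹-nth : ∀ {i z} → nth i w ≡ just z → w⁻¹ z ≡ suc i
  w⁻¹-nth w[i]=z = cong suc (nth-injective w Unique-w (nth-position _ w (nth⇒∈ w w[i]=z)) w[i]=z)

  w⁻¹-injective : ∀ {a b} → a ∈ w → b ∈ w → w⁻¹ a ≡ w⁻¹ b → a ≡ b
  w⁻¹-injective {a} {b} a∈ b∈ eq =
    just-injective (trans (sym (nth-position a w a∈)) (trans (cong (λ k → nth k w) (suc-injective eq)) (nth-position b w b∈)))

  Unique-map-w⁻¹ : ∀ (xs : List ℕ) → Unique xs → All (_∈ w) xs → Unique (map w⁻¹ xs)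
  Unique-map-w⁻¹ []       _          _            = []
  Unique-map-w⁻¹ (x ∷ xs) (x∉ ∷ uniq) (x∈ ∷ xs⊆) =
    All.map⁺ (All.tabulate (λ {y} y∈ eq → All.lookup x∉ y∈ (w⁻¹-injective x∈ (All.lookup xs⊆ y∈) eq)))
    ∷ Unique-map-w⁻¹ xs uniq xs⊆

  isEntry≡w⁻¹ : ∀ p q → p ∈ w → q ∈ R → isEntry w (p , q) ≡ (q ≡ᵇ w⁻¹ p)
  isEntry≡w⁻¹ p q p∈ q∈ with ∈-range1⁻ q∈
  ... | i , refl , i< with <length⇒nth w i<
  ...   | x , w[i]=x =
    trans (cong (_≡ᵇ 1) (matEntry-just w p (suc i) w[i]=x)) (trans (indicator (x ≡ᵇ p)) (≡true⇔⇒≡ ⇒ ⇐))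
    where
    indicator : ∀ b → ((if b then 1 else 0) ≡ᵇ 1) ≡ b
    indicator true  = refl
    indicator false = refl
    ⇒ : (x ≡ᵇ p) ≡ true → (i ≡ᵇ position p w) ≡ true
    ⇒ x≡ᵇp with ≡ᵇ≡true⇒≡ {x} {p} x≡ᵇp
    ... | refl = ≡⇒≡ᵇ≡true (nth-injective w Unique-w w[i]=x (nth-position x w p∈))
    ⇐ : (i ≡ᵇ position p w) ≡ true → (x ≡ᵇ p) ≡ true
    ⇐ i≡ᵇ = ≡⇒≡ᵇ≡true (just-injective (trans (sym w[i]=x)
                        (trans (cong (λ k → nth k w) (≡ᵇ≡true⇒≡ i≡ᵇ)) (nth-position p w p∈))))

  allEntries-zip : ∀ ps π → length ps ≡ length π → All (_∈ w) ps → All (_∈ R) π →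
                   allEntries (L.zipWith _,_ ps π) ≡ sameList π (map w⁻¹ ps)
  allEntries-zip []       []      _    _          _          = refl
  allEntries-zip (p ∷ ps) (q ∷ π) len≡ (p∈ ∷ ps⊆) (q∈ ∷ π⊆) =
    cong₂ _∧_ (isEntry≡w⁻¹ p q p∈ q∈) (allEntries-zip ps π (suc-injective len≡) ps⊆ π⊆)

  invariant : RSKInvariant w (rsk w)
  invariant = rsk-invariant w Unique-w

  Unique-P : Unique (concat P)
  Unique-P = Unique-resp-↭ (↭-sym (P-content invariant)) Unique-w

  Unique-Q : Unique (concat Q)
  Unique-Q = Unique-resp-↭ (↭-sym (Q-content invariant)) (Unique-range1 (length w))

  column-P⊆w : ∀ j {z} → z ∈ column j P → z ∈ w
  column-P⊆w j = ∈-resp-↭ (P-content invariant) ∘ column⇒∈ j P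

  column-Q⊆R : ∀ j {z} → z ∈ column j Q → z ∈ R
  column-Q⊆R j = ∈-resp-↭ (Q-content invariant) ∘ column⇒∈ j Q

  length-column-PQ : ∀ j → length (column j P) ≡ length (column j Q)
  length-column-PQ j = length-column j P Q (same-shape invariant)

  width : ℕ
  width = numCols P

  Q-rows≤width : All (λ r → length r ≤ width) Q
  Q-rows≤width = All.map⁻ (subst (All (_≤ width)) (same-shape invariant) (All.map⁺
    (subst (λ n → All (λ r → length r ≤ n) P) (sym (numCols≡length-bottomRow P))
           (rows≤bottomRow P (P-increasing invariant)))))

  Δ : ℕ → List (ℤ × Monomial)
  Δ j = detTerms (column j P) (column j Q)

  columnTerms : List ℕ → List (ℤ × Monomial)
  columnTerms = L.foldr (λ j acc → mulTerms (Δ j) acc) ((+ 1 , []) ∷ [])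

  columnTerms-monomial : ∀ js {t} → t ∈ columnTerms js →
    All (λ pq → proj₁ pq ∈ concat P × proj₂ pq ∈ concat Q) (proj₂ t)
    × map proj₂ (proj₂ t) ↭ L.concatMap (λ j → column j Q) js
  columnTerms-monomial []       (here refl) = [] , ↭-refl
  columnTerms-monomial (j ∷ js) t∈ with ∈-mulTerms⁻ (Δ j) (columnTerms js) t∈
  ... | a , b , a∈ , b∈ , refl with ∈-detTerms⁻ (column j P) (column j Q) a∈ | columnTerms-monomial js b∈
  ...   | s , s∈ , a≡ | b⊆ , b↭ = All.++⁺ a⊆ b⊆ , a++b↭
    where
    π↭ : proj₂ s ↭ column j Q
    π↭ = signedPerms-↭ (column j Q) s∈
    length≡ : length (column j P) ≡ length (proj₂ s)
    length≡ = trans (length-column-PQ j) (sym (↭-length π↭))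
    a⊆ : All (λ pq → proj₁ pq ∈ concat P × proj₂ pq ∈ concat Q) (proj₂ a)
    a⊆ = subst (All _) (sym a≡) (All.tabulate λ pq∈ →
      let p∈ , q∈ = ∈-zip⁻ (column j P) (proj₂ s) pq∈
      in column⇒∈ j P p∈ , column⇒∈ j Q (∈-resp-↭ π↭ q∈))
    a++b↭ : map proj₂ (proj₂ a ++ proj₂ b) ↭ column j Q ++ L.concatMap (λ j → column j Q) js
    a++b↭ = begin
      map proj₂ (proj₂ a ++ proj₂ b)            ≡⟨ map-++ proj₂ (proj₂ a) (proj₂ b) ⟩
      map proj₂ (proj₂ a) ++ map proj₂ (proj₂ b) ≡⟨ cong (λ m → map proj₂ m ++ map proj₂ (proj₂ b)) a≡ ⟩
      map proj₂ (L.zipWith _,_ (column j P) (proj₂ s)) ++ map proj₂ (proj₂ b)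
        ≡⟨ cong (_++ map proj₂ (proj₂ b)) (map-proj₂-zip (column j P) (proj₂ s) length≡) ⟩
      proj₂ s ++ map proj₂ (proj₂ b)             ↭⟨ ++⁺ π↭ b↭ ⟩
      column j Q ++ L.concatMap (λ j → column j Q) js ∎
      where open PermutationReasoning

  coeffWhere-columnTerms : ∀ js → coeffWhere allEntries (columnTerms js) ≡ ∏ (λ j → coeffWhere allEntries (Δ j)) js
  coeffWhere-columnTerms []       = refl
  coeffWhere-columnTerms (j ∷ js) =
    trans (coeffWhere-mulTerms allEntries (allB-++ (isEntry w)) (Δ j) (columnTerms js))
          (cong (coeffWhere allEntries (Δ j) *_) (coeffWhere-columnTerms js))

  -- Every monomial of [P | Q] uses each column index 1, …, n exactly once,
  -- so its factors decide whether it is z^α.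
  coeffZAlpha≡∏ : coeffZAlpha w ≡ ∏ (λ j → coeffWhere allEntries (Δ j)) (upTo width)
  coeffZAlpha≡∏ = trans (coeffWhere-cong (isZAlpha w) allEntries (columnTerms (upTo width)) is-zα≡)
                        (coeffWhere-columnTerms (upTo width))
    where
    is-zα≡ : ∀ {t} → t ∈ columnTerms (upTo width) → isZAlpha w (proj₂ t) ≡ allEntries (proj₂ t)
    is-zα≡ {t} t∈ =
      let t⊆ , t↭ = columnTerms-monomial (upTo width) t∈
      in isZAlpha≡allEntries (proj₂ t)
           (All.map (λ (p∈ , q∈) → ∈-resp-↭ (↭-trans (P-content invariant) w↭) p∈ , ∈-resp-↭ (Q-content invariant) q∈) t⊆)
           (↭-trans t↭ (↭-trans (concat-columns-↭ Q width Q-rows≤width) (Q-content invariant)))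

  coeffWhere-Δ : ∀ j → coeffWhere allEntries (Δ j) ≡ coeffWhere (λ π → sameList π (map w⁻¹ (column j P))) (signedPerms (column j Q))
  coeffWhere-Δ j =
    trans (coeffWhere-relabel allEntries (L.zipWith _,_ (column j P)) (signedPerms (column j Q)))
          (coeffWhere-cong _ _ (signedPerms (column j Q)) λ {s} s∈ →
             let π↭ = signedPerms-↭ (column j Q) s∈ in
             allEntries-zip (column j P) (proj₂ s) (trans (length-column-PQ j) (sym (↭-length π↭)))
               (All.tabulate (column-P⊆w j)) (All.tabulate (column-Q⊆R j ∘ ∈-resp-↭ π↭)))

  agree⇒column-↭ : ColumnsAgree w P Q → ∀ j → map w⁻¹ (column j P) ↭ column j Q
  agree⇒column-↭ agree j =
    Unique-⊆⊇⇒↭ (Unique-map-w⁻¹ _ (Unique-column j P Unique-P) (All.tabulate (column-P⊆w j)))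
                (Unique-column j Q Unique-Q) ⊆ ⊇
    where
    ⊆ : ∀ {s} → s ∈ map w⁻¹ (column j P) → s ∈ column j Q
    ⊆ s∈ with ∈-map⁻ w⁻¹ s∈
    ... | z , z∈ , refl =
      let j' , z∈P , i∈Q = agree (position z w) z (nth-position z w (column-P⊆w j z∈))
      in InColumn⇒column j Q (subst (λ j → InColumn j Q (w⁻¹ z)) (InColumn-unique Unique-P z∈P (column⇒InColumn j P z∈)) i∈Q)
    ⊇ : ∀ {s} → s ∈ column j Q → s ∈ map w⁻¹ (column j P)
    ⊇ s∈ with ∈-range1⁻ (column-Q⊆R j s∈)
    ... | i , refl , i< =
      let z , w[i]=z = <length⇒nth w i<
          j' , z∈P , i∈Q = agree i z w[i]=z
      in subst (_∈ map w⁻¹ (column j P)) (w⁻¹-nth w[i]=z)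
           (∈-map⁺ w⁻¹ (InColumn⇒column j P (subst (λ j → InColumn j P z) (InColumn-unique Unique-Q i∈Q (column⇒InColumn j Q s∈)) z∈P)))

  disagree⇒column-≁ : ColumnsDisagree w P Q → ∃ λ j → j ∈ upTo width × ¬ (map w⁻¹ (column j P) ↭ column j Q)
  disagree⇒column-≁ (i , z , j , j' , w[i]=z , z∈P , i∈Q , j<j') =
    j , ∈-upTo⁺ (subst (j <_) (sym (numCols≡length-bottomRow P)) (InColumn⇒<width (P-increasing invariant) z∈P)) ,
    λ column↭ →
      let i∈Qj = subst (λ k → InColumn j Q k) (w⁻¹-nth w[i]=z)
                   (column⇒InColumn j Q (∈-resp-↭ column↭ (∈-map⁺ w⁻¹ (InColumn⇒column j P z∈P))))
      in <-irrefl (InColumn-unique Unique-Q i∈Qj i∈Q) j<j'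

  isZero-coeffZAlpha≡anyLateral : isZeroℤ (coeffZAlpha w) ≡ anyLateral (rsk w)
  isZero-coeffZAlpha≡anyLateral with anyLateral (rsk w) in lateral
  ... | false = trans (cong isZeroℤ coeffZAlpha≡∏) (IsSign⇒nonzero (IsSign-∏ (λ j → coeffWhere allEntries (Δ j)) (upTo width) λ {j} _ →
                  subst IsSign (sym (coeffWhere-Δ j))
                    (signedPerms-coeff-IsSign (column j Q) _ (Unique-column j Q Unique-Q)
                      (agree⇒column-↭ (vertical⇒agree invariant lateral) j))))
  ... | true with disagree⇒column-≁ (lateral⇒disagree invariant lateral)
  ...   | j , j∈ , ≁ = cong isZeroℤ (trans coeffZAlpha≡∏
                         (∏-zero (λ j → coeffWhere allEntries (Δ j)) (upTo width) j∈ (trans (coeffWhere-Δ j) (signedPerms-coeff-≁ (column j Q) _ ≁))))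

-- Counting

length-insAll : ∀ y (xs : List ℕ) → length (insAll y xs) ≡ suc (length xs)
length-insAll y []       = refl
length-insAll y (x ∷ xs) = cong suc (trans (length-map _ (insAll y xs)) (length-insAll y xs))

length-concatMap-const : {A B : Set} (f : A → List B) (xs : List A) (k : ℕ) → (∀ {x} → x ∈ xs → length (f x) ≡ k) →
                         length (L.concatMap f xs) ≡ length xs ℕ.* k
length-concatMap-const f []       k _     = refl
length-concatMap-const f (x ∷ xs) k len≡ =
  trans (length-++ (f x)) (cong₂ ℕ._+_ (len≡ (here refl)) (length-concatMap-const f xs k (len≡ ∘ there)))

length-signedPerms : ∀ (qs : List ℕ) → length (signedPerms qs) ≡ length qs !
length-signedPerms []       = refl
length-signedPerms (y ∷ ys) = begin
  length (signedPerms (y ∷ ys))          ≡⟨ length-concatMap-const _ (signedPerms ys) (suc (length ys)) length-inserted ⟩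
  length (signedPerms ys) ℕ.* suc (length ys) ≡⟨ cong (ℕ._* suc (length ys)) (length-signedPerms ys) ⟩
  length ys ! ℕ.* suc (length ys)        ≡⟨ *-comm (length ys !) (suc (length ys)) ⟩
  suc (length ys) !                       ∎
  where
  open ≡-Reasoning
  length-inserted : ∀ {p} → p ∈ signedPerms ys →
                    length (map (λ q → proj₁ p * proj₁ q , proj₂ q) (insAll y (proj₂ p))) ≡ suc (length ys)
  length-inserted {p} p∈ =
    trans (length-map _ (insAll y (proj₂ p))) (trans (length-insAll y (proj₂ p)) (cong suc (↭-length (signedPerms-↭ ys p∈))))

length-Sym : ∀ n → length (Sym n) ≡ n !
length-Sym n = trans (length-map proj₂ (signedPerms (range1 n))) (trans (length-signedPerms (range1 n)) (cong _! (length-range1 n)))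

Sym⇒↭ : ∀ n {w} → w ∈ Sym n → w ↭ range1 (length w)
Sym⇒↭ n w∈ with ∈-map⁻ proj₂ w∈
... | s , s∈ , refl =
  let s↭ = signedPerms-↭ (range1 n) s∈
  in subst (λ k → proj₂ s ↭ range1 k) (sym (trans (↭-length s↭) (length-range1 n))) s↭

length-filterᵇ-complement : {A : Set} (p q : A → Bool) (xs : List A) → (∀ {x} → x ∈ xs → q x ≡ not (p x)) →
                            length (L.filterᵇ p xs) ℕ.+ length (L.filterᵇ q xs) ≡ length xs
length-filterᵇ-complement p q []       _       = refl
length-filterᵇ-complement p q (x ∷ xs) q≡¬p with p x | q x | q≡¬p (here refl)
... | true  | false | _ = cong suc (length-filterᵇ-complement p q xs (q≡¬p ∘ there))
... | false | true  | _ = trans (+-suc _ _) (cong suc (length-filterᵇ-complement p q xs (q≡¬p ∘ there)))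

|V|+|C|≡n! : ∀ n → length (V n) ℕ.+ length (C n) ≡ n !
|V|+|C|≡n! n =
  trans (length-filterᵇ-complement noLateral (λ w → isZeroℤ (coeffZAlpha w)) (Sym n)
          (λ w∈ → trans (isZero-coeffZAlpha≡anyLateral _ (Sym⇒↭ n w∈)) (sym (not-involutive _))))
        (length-Sym n)

common-denominator : ∀ a b (D : ℤ) → (+ a * D + + b * D) * D ≡ + (a ℕ.+ b) * (D * D)
common-denominator a b D = begin
  (+ a * D + + b * D) * D ≡⟨ cong (_* D) (ℤ.*-distribʳ-+ D (+ a) (+ b)) ⟨
  (+ a + + b) * D * D     ≡⟨ ℤ.*-assoc (+ a + + b) D D ⟩
  (+ a + + b) * (D * D)   ≡⟨ cong (_* (D * D)) (ℤ.pos-+ a b) ⟨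
  + (a ℕ.+ b) * (D * D)   ∎
  where open ≡-Reasoning

a/N+b/N≡a+b/N : ∀ a b N .{{_ : ℕ.NonZero N}} → (+ a ℚ./ N) ℚ.+ (+ b ℚ./ N) ≡ + (a ℕ.+ b) ℚ./ N
a/N+b/N≡a+b/N a b (suc d) = ℚ.toℚᵘ-injective (begin
  ℚ.toℚᵘ (ℚ.fromℚᵘ (mkℚᵘ (+ a) d) ℚ.+ ℚ.fromℚᵘ (mkℚᵘ (+ b) d))
    ≈⟨ ℚ.toℚᵘ-homo-+ (ℚ.fromℚᵘ (mkℚᵘ (+ a) d)) (ℚ.fromℚᵘ (mkℚᵘ (+ b) d)) ⟩
  ℚ.toℚᵘ (ℚ.fromℚᵘ (mkℚᵘ (+ a) d)) ℚᵘ.+ ℚ.toℚᵘ (ℚ.fromℚᵘ (mkℚᵘ (+ b) d))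
    ≈⟨ ℚᵘ.+-cong (ℚ.toℚᵘ-fromℚᵘ (mkℚᵘ (+ a) d)) (ℚ.toℚᵘ-fromℚᵘ (mkℚᵘ (+ b) d)) ⟩
  mkℚᵘ (+ a) d ℚᵘ.+ mkℚᵘ (+ b) d
    ≈⟨ ℚᵘ.*≡* (common-denominator a b (+ suc d)) ⟩
  mkℚᵘ (+ (a ℕ.+ b)) d
    ≈⟨ ℚ.toℚᵘ-fromℚᵘ (mkℚᵘ (+ (a ℕ.+ b)) d) ⟨
  ℚ.toℚᵘ (ℚ.fromℚᵘ (mkℚᵘ (+ (a ℕ.+ b)) d)) ∎)
  where open ℚᵘ.≃-Reasoning

N/N≡1 : ∀ N .{{_ : ℕ.NonZero N}} → + N ℚ./ N ≡ 1ℚ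
N/N≡1 (suc d) = ℚ.toℚᵘ-injective (ℚᵘ.≃-trans (ℚ.toℚᵘ-fromℚᵘ (mkℚᵘ (+ suc d) d))
                             (ℚᵘ.*≡* (ℤ.*-comm (+ suc d) (+ 1))))

∣p-0∣≡∣q-1∣ : ∀ {p q} → p ℚ.+ q ≡ 1ℚ → ∣ p - 0ℚ ∣ ≡ ∣ q - 1ℚ ∣
∣p-0∣≡∣q-1∣ {p} {q} p+q≡1 = begin
  ∣ p - 0ℚ ∣   ≡⟨ cong ∣_∣ (ℚ.+-identityʳ p) ⟩
  ∣ p ∣        ≡⟨ ℚ.∣-p∣≡∣p∣ p ⟨
  ∣ ℚ.- p ∣    ≡⟨ cong ∣_∣ q-1≡-p ⟨
  ∣ q - 1ℚ ∣   ∎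
  where
  open ≡-Reasoning
  q-1≡-p : q - 1ℚ ≡ ℚ.- p
  q-1≡-p = begin
    q - 1ℚ                   ≡⟨ cong (λ r → q - r) (sym p+q≡1) ⟩
    q ℚ.+ ℚ.- (p ℚ.+ q)      ≡⟨ cong (q ℚ.+_) (trans (ℚ.neg-distrib-+ p q) (ℚ.+-comm (ℚ.- p) (ℚ.- q))) ⟩
    q ℚ.+ (ℚ.- q ℚ.+ ℚ.- p)  ≡⟨ ℚ.+-assoc q (ℚ.- q) (ℚ.- p) ⟨
    (q ℚ.+ ℚ.- q) ℚ.+ ℚ.- p  ≡⟨ cong (ℚ._+ ℚ.- p) (ℚ.+-inverseʳ q) ⟩
    0ℚ ℚ.+ ℚ.- p             ≡⟨ ℚ.+-identityˡ (ℚ.- p) ⟩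
    ℚ.- p                    ∎

ratio-V+ratio-C≡1 : ∀ n → ratio V n ℚ.+ ratio C n ≡ 1ℚ
ratio-V+ratio-C≡1 n = begin
  ratio V n ℚ.+ ratio C n                ≡⟨ a/N+b/N≡a+b/N (length (V n)) (length (C n)) (n !) ⦃ n !≢0 ⦄ ⟩
  (+ (length (V n) ℕ.+ length (C n)) ℚ./ n !) ⦃ n !≢0 ⦄ ≡⟨ cong (λ k → (+ k ℚ./ n !) ⦃ n !≢0 ⦄) (|V|+|C|≡n! n) ⟩
  (+ (n !) ℚ./ n !) ⦃ n !≢0 ⦄            ≡⟨ N/N≡1 (n !) ⦃ n !≢0 ⦄ ⟩
  1ℚ                                     ∎
  where open ≡-Reasoning
⟶-resp-distance : ∀ {f g : ℕ → ℚ} {ℓ m} → (∀ n → ∣ f n - ℓ ∣ ≡ ∣ g n - m ∣) → f ⟶ ℓ → g ⟶ m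
⟶-resp-distance dist≡ f⟶ℓ ε ε>0 =
  let N , close = f⟶ℓ ε ε>0 in N , λ n n≥N → subst (ℚ._< ε) (dist≡ n) (close n n≥N)

corollary2p6 : (ratio V ⟶ 0ℚ) ⇔ (ratio C ⟶ 1ℚ)
corollary2p6 = mk⇔ (⟶-resp-distance {ratio V} {ratio C} {0ℚ} {1ℚ} distance≡)
                   (⟶-resp-distance {ratio C} {ratio V} {1ℚ} {0ℚ} (sym ∘ distance≡))
  where
  distance≡ : ∀ n → ∣ ratio V n - 0ℚ ∣ ≡ ∣ ratio C n - 1ℚ ∣
  distance≡ n = ∣p-0∣≡∣q-1∣ {ratio V n} {ratio C n} (ratio-V+ratio-C≡1 n)
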